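{- Let $n\in\mathbb{N}$. Then $\Phi_n(i)\in\mathbb{Z}[i]$, and: (i) if $4\nmid n$ then $\Phi_n(i)\in\{ -1,\,-1+i,\,-i,\,i,\,1,\,1+i\}$; (ii) if $4\mid n$ then $\Phi_n(i)=0$ if $n=4$; $\Phi_n(i)=p$ if $n=4p^j$ for some prime number $p$ and some $j\in\mathbb{N}$; and $\Phi_n(i)=1$ otherwise.
   Context: $\Phi_n(z)=\prod_{1\le j\le n,\ \gcd(j,n)=1}(z-e^{2\pi i j/n})$ is the $n$-th cyclotomic polynomial, $i$ is the imaginary unit, and $\mathbb{Z}[i]=\{k+il:k,l\in\mathbb{Z}\}$ is the ring of Gaussian integers. -}

module Defs where

open import Data.Nat as ℕ using (ℕ; zero; suc; _∸_; _<ᵇ_)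
open import Data.Nat.Divisibility using (_∣?_)
open import Data.Integer as ℤ using (ℤ; +_; -[1+_])
open import Data.List using (List; []; _∷_; [_]; _++_; map; reverse; length; drop; replicate; foldr)
open import Data.Bool using (true; false; if_then_else_)
open import Relation.Nullary using (does)

-- Integer polynomials, as coefficient lists (lowest degree first).

Poly : Set
Poly = List ℤ

infixl 6 _+ₚ_
infixl 7 _*ₚ_

_+ₚ_ : Poly → Poly → Poly
[]       +ₚ q        = q
p        +ₚ []       = p
(a ∷ p)  +ₚ (b ∷ q)  = (a ℤ.+ b) ∷ (p +ₚ q)

_*ₚ_ : Poly → Poly → Poly
[]      *ₚ q = []
(a ∷ p) *ₚ q = map (a ℤ.*_) q +ₚ (+ 0 ∷ (p *ₚ q))

productₚ : List Poly → Poly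
productₚ = foldr _*ₚ_ [ + 1 ]

-- x^n - 1  (for n ≥ 1)
xⁿ-1 : ℕ → Poly
xⁿ-1 n = -[1+ 0 ] ∷ (replicate (n ∸ 1) (+ 0) ++ [ + 1 ])

-- Division by a monic polynomial (long division; exact when the
-- divisor divides the dividend).  Lists here are highest degree first.
private
  subFront : List ℤ → List ℤ → List ℤ
  subFront (x ∷ xs) (y ∷ ys) = (x ℤ.- y) ∷ subFront xs ys
  subFront xs       _        = xs

  divHL : ℕ → List ℤ → List ℤ → List ℤ
  divHL zero    _        _  = []
  divHL (suc k) []       gT = []
  divHL (suc k) (a ∷ rest) gT =
    if length rest <ᵇ length gT then []
    else a ∷ divHL k (subFront rest (map (a ℤ.*_) gT)) gT

divMonic : Poly → Poly → Poly
divMonic f g = reverse (divHL (length f) (reverse f) (drop 1 (reverse g)))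

-- Cyclotomic polynomials, via  x^n - 1 = ∏_{d ∣ n} Φ_d(x)  (n ≥ 1),
-- i.e. Φ_n = (x^n - 1) / ∏_{d ∣ n, d < n} Φ_d.  Φ_0 = 1 (empty product).

-- select, from [Φ_d, Φ_{d+1}, ...], those Φ_e with e ∣ m
private
  selectDiv : ℕ → ℕ → List Poly → List Poly
  selectDiv m d []       = []
  selectDiv m d (p ∷ ps) =
    if does (d ∣? m) then p ∷ selectDiv m (suc d) ps else selectDiv m (suc d) ps

cyclos : ℕ → List Poly
cyclos zero    = []
cyclos (suc n) = cyclos n ++ [ divMonic (xⁿ-1 (suc n)) (productₚ (selectDiv (suc n) 1 (cyclos n))) ]

Φ : ℕ → Poly
Φ zero    = [ + 1 ]
Φ (suc n) = divMonic (xⁿ-1 (suc n)) (productₚ (selectDiv (suc n) 1 (cyclos n)))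

infix 5 _+i_

record ℤ[i] : Set where
  constructor _+i_
  field
    re : ℤ
    im : ℤ

evalAtI : Poly → ℤ[i]
evalAtI []      = + 0 +i + 0
evalAtI (a ∷ p) with evalAtI p
... | x +i y = (a ℤ.- y) +i x     -- a + i·(x + i y)

{-# OPTIONS --safe #-}
module Submission where

-- Defs computes Φ n as the quotient of X^n - 1 by the product of the earlier Φ d, d ∣ n.
-- By strong induction these Φ d are monic and pairwise coprime over ℚ, so their product
-- divides X^n - 1 in ℤ[X] and the division is exact: X^n - 1 = ∏_{d ∣ n} Φ d.
--
-- Evaluating at i: if 4 ∤ n, the norms of the Φ d (i) multiply to |i^n - 1|² ∈ {2, 4},
-- which Φ 1 (i) = i - 1 and Φ 2 (i) = i + 1 already account for, so Φ n (i) is a unit.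
-- If n = 4k, cancelling Φ 4 = X² + 1 from X^4k - 1 = (X^4 - 1)(1 + X^4 + ⋯ + X^4(k-1))
-- and evaluating gives ∏_{d ∣ 4k, d ≠ 4} Φ d (i) = -2k, where the d with 4 ∤ d contribute
-- i^2u - 1 = -2 (k = 2^a u, u odd).  Hence W e = Φ (4e) (i) satisfies ∏_{1 < e ∣ k} W e = k
-- for all k ≥ 1, which forces W (p^j) = p and W k = 1 if k is not a prime power: for
-- k = p^(1+a) r with p ∤ r, dividing by the same identity at k/p leaves
-- ∏_{e ∣ r} W (p^(1+a) e) = p.

open import Defs
open import Data.Nat using (ℕ; _*_; _^_; _≤_)
open import Data.Nat.Divisibility using (_∣_)
open import Data.Nat.Primality using (Prime)
open import Data.Integer using (+_; -[1+_])
open import Data.List using (_∷_; [])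
open import Data.List.Membership.Propositional using (_∈_)
open import Data.Product using (_×_)
open import Relation.Nullary using (¬_)
open import Relation.Binary.PropositionalEquality using (_≡_; _≢_)

open import Level using (0ℓ)
open import Data.Nat as ℕ using (zero; suc; _<_; z≤n; s≤s; _∸_; _<ᵇ_; _%_; _/_; NonZero)
import Data.Nat.Properties as ℕ
import Data.Nat.DivMod as ℕ
open import Data.Nat.Divisibility as ℕ using (_∣?_; divides)
open import Data.Nat.GCD using (gcd; gcd-GCD; module Bézout; gcd[m,n]∣m; gcd[m,n]∣n; gcd[m,n]≢0)
open import Data.Nat.Induction using (<-rec)
open import Data.Nat.Primality using (prime[2]; prime⇒irreducible; prime⇒nonZero; prime⇒nonTrivial; euclidsLemma)
open import Data.Nat.Coprimality using (Coprime; coprime-divisor)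
open import Data.Nat.Primality.Factorisation using (factorise)
open import Data.Integer as ℤ using (ℤ)
import Data.Integer.Properties as ℤ
open import Data.Integer.Solver using () renaming (module +-*-Solver to ℤ-Solver)
open import Data.List using (List; map; _++_; length; [_]; reverse; drop; replicate)
import Data.List.Properties as List
open import Data.List.Relation.Unary.All using (All; []; _∷_)
import Data.List.Relation.Unary.All.Properties as All
open import Data.List.Relation.Unary.Any using (here; there)
open import Data.Bool using (true; false; if_then_else_; T)
open import Data.Unit using (tt)
open import Data.Empty using (⊥-elim)
open import Data.Maybe using (Maybe; just; nothing)
open import Data.Product using (∃; ∃₂; _,_; proj₁; proj₂)
open import Data.Sum using (_⊎_; inj₁; inj₂; [_,_]′)
open import Function using (_∘_)
open import Relation.Nullary using (yes; no; does; contradiction)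
open import Relation.Unary using (Pred; Decidable; _∩_; ∁)
open import Relation.Unary.Properties using (_∩?_; ∁?)
open import Relation.Binary.PropositionalEquality using (refl; sym; trans; cong; cong₂; subst; isEquivalence; module ≡-Reasoning)
open import Relation.Binary.Bundles using (Setoid)
open import Relation.Binary.Structures using (IsEquivalence)
open import Algebra.Bundles using (CommutativeMonoid; CommutativeRing)
open import Algebra.Structures using (IsCommutativeRing)
open import Algebra.Solver.Ring.AlmostCommutativeRing using (fromCommutativeRing; _-Raw-AlmostCommutative⟶_)
import Algebra.Solver.Ring

-- Products over filtered ranges

module FilteredProduct {c ℓ} (M : CommutativeMonoid c ℓ) where

  open CommutativeMonoid M renaming (refl to ≈-refl; sym to ≈-sym; trans to ≈-trans)
  open import Algebra.Definitions.RawMagma rawMagma using (_,_) renaming (_∣_ to _∣ᴹ_)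

  ∏ : {P : Pred ℕ 0ℓ} → ℕ → Decidable P → (ℕ → Carrier) → Carrier
  ∏ zero    P? f = ε
  ∏ (suc n) P? f = if does (P? (suc n)) then ∏ n P? f ∙ f (suc n) else ∏ n P? f

  private
    variable
      P Q : Pred ℕ 0ℓ

  ∏-suc-yes : ∀ n (P? : Decidable P) f → P (suc n) → ∏ (suc n) P? f ≡ ∏ n P? f ∙ f (suc n)
  ∏-suc-yes n P? f p with P? (suc n)
  ... | yes _  = refl
  ... | no ¬p = contradiction p ¬p

  ∏-suc-no : ∀ n (P? : Decidable P) f → ¬ P (suc n) → ∏ (suc n) P? f ≡ ∏ n P? f
  ∏-suc-no n P? f ¬p with P? (suc n)
  ... | yes p = contradiction p ¬p
  ... | no  _ = refl

  ∏-cong : ∀ n (P? : Decidable P) {f g : ℕ → Carrier} →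
           (∀ {j} → 1 ≤ j → j ≤ n → P j → f j ≈ g j) → ∏ n P? f ≈ ∏ n P? g
  ∏-cong zero    P? f≈g = ≈-refl
  ∏-cong (suc n) P? f≈g with P? (suc n)
  ... | yes p = ∙-cong (∏-cong n P? (λ 1≤j j≤n → f≈g 1≤j (ℕ.m≤n⇒m≤1+n j≤n))) (f≈g (s≤s z≤n) ℕ.≤-refl p)
  ... | no  _ = ∏-cong n P? (λ 1≤j j≤n → f≈g 1≤j (ℕ.m≤n⇒m≤1+n j≤n))

  ∏-congᵖ : ∀ n (P? : Decidable P) (Q? : Decidable Q) {f} →
            (∀ {j} → 1 ≤ j → j ≤ n → P j → Q j) → (∀ {j} → 1 ≤ j → j ≤ n → Q j → P j) →
            ∏ n P? f ≡ ∏ n Q? f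
  ∏-congᵖ zero    P? Q? P⇒Q Q⇒P = refl
  ∏-congᵖ (suc n) P? Q? P⇒Q Q⇒P with P? (suc n) | Q? (suc n)
  ... | yes _ | yes _ = cong (_∙ _) (∏-congᵖ n P? Q? (λ 1≤j → P⇒Q 1≤j ∘ ℕ.m≤n⇒m≤1+n) (λ 1≤j → Q⇒P 1≤j ∘ ℕ.m≤n⇒m≤1+n))
  ... | no  _ | no  _ = ∏-congᵖ n P? Q? (λ 1≤j → P⇒Q 1≤j ∘ ℕ.m≤n⇒m≤1+n) (λ 1≤j → Q⇒P 1≤j ∘ ℕ.m≤n⇒m≤1+n)
  ... | yes p | no ¬q = contradiction (P⇒Q (s≤s z≤n) ℕ.≤-refl p) ¬q
  ... | no ¬p | yes q = contradiction (Q⇒P (s≤s z≤n) ℕ.≤-refl q) ¬p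

  ∏-range : ∀ {m n} (P? : Decidable P) f → m ≤ n → (∀ {j} → m < j → j ≤ n → ¬ P j) → ∏ n P? f ≡ ∏ m P? f
  ∏-range {n = zero}  P? f z≤n  _ = refl
  ∏-range {n = suc n} P? f m≤n ¬P with ℕ.m≤n⇒m<n∨m≡n m≤n
  ... | inj₂ refl = refl
  ... | inj₁ (s≤s m≤n′) with P? (suc n)
  ...   | yes p = contradiction p (¬P (s≤s m≤n′) ℕ.≤-refl)
  ...   | no  _ = ∏-range P? f m≤n′ (λ m<j j≤n → ¬P m<j (ℕ.m≤n⇒m≤1+n j≤n))

  ∏-trivial : ∀ n (P? : Decidable P) {f} → (∀ {j} → 1 ≤ j → j ≤ n → P j → f j ≈ ε) → ∏ n P? f ≈ ε
  ∏-trivial n P? {f} f≈ε = ≈-trans (∏-cong n P? f≈ε) (constant n)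
    where
    constant : ∀ n → ∏ n P? (λ _ → ε) ≈ ε
    constant zero = ≈-refl
    constant (suc n) with P? (suc n)
    ... | yes _ = ≈-trans (identityʳ _) (constant n)
    ... | no  _ = constant n

  ∏-split : ∀ n (P? : Decidable P) (Q? : Decidable Q) f → ∏ n P? f ≈ ∏ n (P? ∩? Q?) f ∙ ∏ n (P? ∩? ∁? Q?) f
  ∏-split zero    P? Q? f = ≈-sym (identityˡ ε)
  ∏-split (suc n) P? Q? f with P? (suc n) | Q? (suc n)
  ... | no _  | _     = ∏-split n P? Q? f
  ... | yes _ | yes _ = begin
    ∏ n P? f ∙ f (suc n)          ≈⟨ ∙-congʳ (∏-split n P? Q? f) ⟩
    (A ∙ B) ∙ f (suc n)            ≈⟨ assoc A B (f (suc n)) ⟩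
    A ∙ (B ∙ f (suc n))            ≈⟨ ∙-congˡ (comm B (f (suc n))) ⟩
    A ∙ (f (suc n) ∙ B)            ≈⟨ ≈-sym (assoc A (f (suc n)) B) ⟩
    (A ∙ f (suc n)) ∙ B            ∎
    where
    open import Relation.Binary.Reasoning.Setoid setoid
    A : Carrier
    A = ∏ n (P? ∩? Q?) f
    B : Carrier
    B = ∏ n (P? ∩? ∁? Q?) f
  ... | yes _ | no _  = ≈-trans (∙-congʳ (∏-split n P? Q? f)) (assoc _ _ (f (suc n)))

  private
    ∏-single : ∀ {a} n (P? : Decidable P) (E? : Decidable (_≡ a)) f → 1 ≤ a → a ≤ n → P a → ∏ n (P? ∩? E?) f ≈ f a
    ∏-single zero P? E? f 1≤a a≤0 Pa = contradiction a≤0 (ℕ.<⇒≱ 1≤a)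
    ∏-single (suc n) P? E? f 1≤a a≤n Pa with P? (suc n) | E? (suc n)
    ... | yes _ | no sn≢a = ∏-single n P? E? f 1≤a (ℕ.≤-pred (ℕ.≤∧≢⇒< a≤n (λ a≡sn → sn≢a (sym a≡sn)))) Pa
    ... | no _  | no sn≢a = ∏-single n P? E? f 1≤a (ℕ.≤-pred (ℕ.≤∧≢⇒< a≤n (λ a≡sn → sn≢a (sym a≡sn)))) Pa
    ... | no ¬Pa | yes refl = contradiction Pa ¬Pa
    ... | yes _ | yes refl =
      ≈-trans (∙-congʳ (∏-trivial n (P? ∩? E?) λ { _ j≤n (_ , refl) → contradiction j≤n (ℕ.<⇒≱ ℕ.≤-refl) }))
              (identityˡ (f (suc n)))

  ∏-extract : ∀ {n a} (P? : Decidable P) f → 1 ≤ a → a ≤ n → P a →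
              ∏ n P? f ≈ f a ∙ ∏ n (P? ∩? ∁? (ℕ._≟ a)) f
  ∏-extract {n = n} {a} P? f 1≤a a≤n Pa =
    ≈-trans (∏-split n P? (ℕ._≟ a) f) (∙-congʳ (∏-single n P? (ℕ._≟ a) f 1≤a a≤n Pa))

  ∏-scale : ∀ k .{{_ : NonZero k}} n (P? : Decidable P) f → (∀ {j} → P j → k ℕ.∣ j) →
            ∏ (k ℕ.* n) P? f ≡ ∏ n (P? ∘ (k ℕ.*_)) (f ∘ (k ℕ.*_))
  ∏-scale k zero P? f k∣ = cong (λ m → ∏ m P? f) (ℕ.*-zeroʳ k)
  ∏-scale K@(suc k) (suc n) P? f K∣ = begin
    ∏ (K ℕ.* suc n) P? f
      ≡⟨ cong (λ m → ∏ m P? f) (ℕ.*-suc K n) ⟩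
    ∏ (suc (k ℕ.+ K ℕ.* n)) P? f
      ≡⟨ cong (λ m → if does (P? m) then ∏ (k ℕ.+ K ℕ.* n) P? f ∙ f m else ∏ (k ℕ.+ K ℕ.* n) P? f)
              (sym (ℕ.*-suc K n)) ⟩
    top (∏ (k ℕ.+ K ℕ.* n) P? f)
      ≡⟨ cong top (∏-range P? f (ℕ.m≤n+m (K ℕ.* n) k) (λ lo hi → between lo hi ∘ K∣)) ⟩
    top (∏ (K ℕ.* n) P? f)
      ≡⟨ cong top (∏-scale K n P? f K∣) ⟩
    ∏ (suc n) (P? ∘ (K ℕ.*_)) (f ∘ (K ℕ.*_)) ∎
    where
    open ≡-Reasoning
    top : Carrier → Carrier
    top x = if does (P? (K ℕ.* suc n)) then x ∙ f (K ℕ.* suc n) else x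
    between : ∀ {j} → K ℕ.* n < j → j ≤ k ℕ.+ K ℕ.* n → ¬ K ℕ.∣ j
    between {j} lo hi (divides q refl) =
      ℕ.<⇒≱ (ℕ.*-cancelʳ-< K n q (subst (ℕ._< q ℕ.* K) (ℕ.*-comm K n) lo))
            (ℕ.≤-pred (ℕ.*-cancelʳ-< K q (suc n)
              (subst (q ℕ.* K ℕ.<_) (trans (sym (ℕ.*-suc K n)) (ℕ.*-comm K (suc n))) (s≤s hi))))

  ∏-⊆-∣ : ∀ n (P? : Decidable P) (Q? : Decidable Q) f → (∀ {j} → 1 ≤ j → j ≤ n → P j → Q j) → ∏ n P? f ∣ᴹ ∏ n Q? f
  ∏-⊆-∣ n P? Q? f P⇒Q = ∏ n (Q? ∩? ∁? P?) f , (begin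
    ∏ n (Q? ∩? ∁? P?) f ∙ ∏ n P? f         ≈⟨ comm _ _ ⟩
    ∏ n P? f ∙ ∏ n (Q? ∩? ∁? P?) f         ≡⟨ cong (_∙ ∏ n (Q? ∩? ∁? P?) f) P≡Q∩P ⟩
    ∏ n (Q? ∩? P?) f ∙ ∏ n (Q? ∩? ∁? P?) f ≈⟨ ≈-sym (∏-split n Q? P? f) ⟩
    ∏ n Q? f                                ∎)
    where
    open import Relation.Binary.Reasoning.Setoid setoid
    P≡Q∩P : ∏ n P? f ≡ ∏ n (Q? ∩? P?) f
    P≡Q∩P = ∏-congᵖ n P? (Q? ∩? P?) (λ 1≤j j≤n p → P⇒Q 1≤j j≤n p , p) (λ _ _ → proj₂)

  ∏-closed : ∀ {q} (R : Carrier → Set q) n (P? : Decidable P) f → R ε → (∀ {x y} → R x → R y → R (x ∙ y)) →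
             (∀ {j} → 1 ≤ j → j ≤ n → P j → R (f j)) → R (∏ n P? f)
  ∏-closed R zero    P? f Rε R∙ Rf = Rε
  ∏-closed R (suc n) P? f Rε R∙ Rf with P? (suc n)
  ... | yes p = R∙ (∏-closed R n P? f Rε R∙ (λ 1≤j → Rf 1≤j ∘ ℕ.m≤n⇒m≤1+n)) (Rf (s≤s z≤n) ℕ.≤-refl p)
  ... | no  _ = ∏-closed R n P? f Rε R∙ (λ 1≤j → Rf 1≤j ∘ ℕ.m≤n⇒m≤1+n)

module _ {c₁ ℓ₁ c₂ ℓ₂} (M : CommutativeMonoid c₁ ℓ₁) (N : CommutativeMonoid c₂ ℓ₂) where

  private
    module M = CommutativeMonoid M
    module N = CommutativeMonoid N
    module ∏M = FilteredProduct M
    module ∏N = FilteredProduct N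

  ∏-homomorphic : ∀ (h : M.Carrier → N.Carrier) → h M.ε N.≈ N.ε → (∀ x y → h (x M.∙ y) N.≈ h x N.∙ h y) →
                  ∀ n {P : Pred ℕ 0ℓ} (P? : Decidable P) f → h (∏M.∏ n P? f) N.≈ ∏N.∏ n P? (h ∘ f)
  ∏-homomorphic h h-ε h-∙ zero    P? f = h-ε
  ∏-homomorphic h h-ε h-∙ (suc n) P? f with P? (suc n)
  ... | yes _ = N.trans (h-∙ _ _) (N.∙-congʳ (∏-homomorphic h h-ε h-∙ n P? f))
  ... | no  _ = ∏-homomorphic h h-ε h-∙ n P? f

-- Integer polynomials

infix 4 _≈ₚ_
data _≈ₚ_ : Poly → Poly → Set where
  []    : [] ≈ₚ []
  []≈0∷ : ∀ {q} → [] ≈ₚ q → [] ≈ₚ + 0 ∷ q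
  0∷≈[] : ∀ {p} → p ≈ₚ [] → + 0 ∷ p ≈ₚ []
  _∷_   : ∀ {a b p q} → a ≡ b → p ≈ₚ q → a ∷ p ≈ₚ b ∷ q

≈ₚ-refl : ∀ {p} → p ≈ₚ p
≈ₚ-refl {[]}    = []
≈ₚ-refl {a ∷ p} = refl ∷ ≈ₚ-refl

≈ₚ-reflexive : ∀ {p q} → p ≡ q → p ≈ₚ q
≈ₚ-reflexive refl = ≈ₚ-refl

≈ₚ-sym : ∀ {p q} → p ≈ₚ q → q ≈ₚ p
≈ₚ-sym []          = []
≈ₚ-sym ([]≈0∷ e)   = 0∷≈[] (≈ₚ-sym e)
≈ₚ-sym (0∷≈[] e)   = []≈0∷ (≈ₚ-sym e)
≈ₚ-sym (a≡b ∷ e)   = sym a≡b ∷ ≈ₚ-sym e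

≈ₚ-trans : ∀ {p q r} → p ≈ₚ q → q ≈ₚ r → p ≈ₚ r
≈ₚ-trans []           f            = f
≈ₚ-trans ([]≈0∷ e)    (0∷≈[] f)    = []
≈ₚ-trans ([]≈0∷ e)    (refl ∷ f)   = []≈0∷ (≈ₚ-trans e f)
≈ₚ-trans (0∷≈[] e)    []           = 0∷≈[] e
≈ₚ-trans (0∷≈[] e)    ([]≈0∷ f)    = refl ∷ ≈ₚ-trans e f
≈ₚ-trans (refl ∷ e)   (0∷≈[] f)    = 0∷≈[] (≈ₚ-trans e f)
≈ₚ-trans (a≡b ∷ e)    (b≡c ∷ f)    = trans a≡b b≡c ∷ ≈ₚ-trans e f

≈ₚ-isEquivalence : IsEquivalence _≈ₚ_
≈ₚ-isEquivalence = record { refl = ≈ₚ-refl ; sym = ≈ₚ-sym ; trans = ≈ₚ-trans }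

≈ₚ-setoid : Setoid _ _
≈ₚ-setoid = record { isEquivalence = ≈ₚ-isEquivalence }

module _ where

  open import Relation.Binary.Reasoning.Setoid ≈ₚ-setoid

  -ₚ_ : Poly → Poly
  -ₚ_ = map (λ a → ℤ.- a)

  infixr 7 _·ₚ_
  _·ₚ_ : ℤ → Poly → Poly
  a ·ₚ p = map (a ℤ.*_) p

  1ₚ : Poly
  1ₚ = + 1 ∷ []

  +ₚ-identityʳ : ∀ p → p +ₚ [] ≡ p
  +ₚ-identityʳ []      = refl
  +ₚ-identityʳ (a ∷ p) = refl

  +ₚ-comm : ∀ p q → p +ₚ q ≡ q +ₚ p
  +ₚ-comm []      q       = sym (+ₚ-identityʳ q)
  +ₚ-comm (a ∷ p) []      = refl
  +ₚ-comm (a ∷ p) (b ∷ q) = cong₂ _∷_ (ℤ.+-comm a b) (+ₚ-comm p q)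

  +ₚ-assoc : ∀ p q r → (p +ₚ q) +ₚ r ≡ p +ₚ (q +ₚ r)
  +ₚ-assoc []      q       r       = refl
  +ₚ-assoc (a ∷ p) []      r       = refl
  +ₚ-assoc (a ∷ p) (b ∷ q) []      = refl
  +ₚ-assoc (a ∷ p) (b ∷ q) (c ∷ r) = cong₂ _∷_ (ℤ.+-assoc a b c) (+ₚ-assoc p q r)

  +ₚ-vanishingˡ : ∀ {z} q → [] ≈ₚ z → z +ₚ q ≈ₚ q
  +ₚ-vanishingˡ q       []        = ≈ₚ-refl
  +ₚ-vanishingˡ []      ([]≈0∷ e) = 0∷≈[] (≈ₚ-sym e)
  +ₚ-vanishingˡ (b ∷ q) ([]≈0∷ e) = ℤ.+-identityˡ b ∷ +ₚ-vanishingˡ q e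

  +ₚ-congˡ : ∀ {p p′} q → p ≈ₚ p′ → p +ₚ q ≈ₚ p′ +ₚ q
  +ₚ-congˡ q       []         = ≈ₚ-refl
  +ₚ-congˡ q       ([]≈0∷ e)  = ≈ₚ-sym (+ₚ-vanishingˡ q ([]≈0∷ e))
  +ₚ-congˡ q       (0∷≈[] e)  = +ₚ-vanishingˡ q ([]≈0∷ (≈ₚ-sym e))
  +ₚ-congˡ []      (a≡b ∷ e)  = a≡b ∷ e
  +ₚ-congˡ (c ∷ q) (a≡b ∷ e)  = cong (ℤ._+ c) a≡b ∷ +ₚ-congˡ q e

  +ₚ-congʳ : ∀ p {q q′} → q ≈ₚ q′ → p +ₚ q ≈ₚ p +ₚ q′
  +ₚ-congʳ p {q} {q′} e = begin
    p +ₚ q  ≡⟨ +ₚ-comm p q ⟩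
    q +ₚ p  ≈⟨ +ₚ-congˡ p e ⟩
    q′ +ₚ p ≡⟨ +ₚ-comm q′ p ⟩
    p +ₚ q′ ∎

  +ₚ-cong : ∀ {p p′ q q′} → p ≈ₚ p′ → q ≈ₚ q′ → p +ₚ q ≈ₚ p′ +ₚ q′
  +ₚ-cong {p′ = p′} {q = q} e f = ≈ₚ-trans (+ₚ-congˡ q e) (+ₚ-congʳ p′ f)

  +ₚ-inverseʳ : ∀ p → p +ₚ -ₚ p ≈ₚ []
  +ₚ-inverseʳ []      = []
  +ₚ-inverseʳ (a ∷ p) = ≈ₚ-trans (ℤ.+-inverseʳ a ∷ ≈ₚ-refl) (0∷≈[] (+ₚ-inverseʳ p))

  +ₚ-inverseˡ : ∀ p → -ₚ p +ₚ p ≈ₚ []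
  +ₚ-inverseˡ p = ≈ₚ-trans (≈ₚ-reflexive (+ₚ-comm (-ₚ p) p)) (+ₚ-inverseʳ p)

  -ₚ-cong : ∀ {p q} → p ≈ₚ q → -ₚ p ≈ₚ -ₚ q
  -ₚ-cong []           = []
  -ₚ-cong ([]≈0∷ e)    = []≈0∷ (-ₚ-cong e)
  -ₚ-cong (0∷≈[] e)    = 0∷≈[] (-ₚ-cong e)
  -ₚ-cong (a≡b ∷ e)    = cong ℤ.-_ a≡b ∷ -ₚ-cong e

  ·ₚ-cong : ∀ a {p q} → p ≈ₚ q → a ·ₚ p ≈ₚ a ·ₚ q
  ·ₚ-cong a []        = []
  ·ₚ-cong a ([]≈0∷ e) = ≈ₚ-trans ([]≈0∷ (·ₚ-cong a e)) (sym (ℤ.*-zeroʳ a) ∷ ≈ₚ-refl)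
  ·ₚ-cong a (0∷≈[] e) = ≈ₚ-trans (ℤ.*-zeroʳ a ∷ ≈ₚ-refl) (0∷≈[] (·ₚ-cong a e))
  ·ₚ-cong a (a≡b ∷ e) = cong (a ℤ.*_) a≡b ∷ ·ₚ-cong a e

  0·ₚ : ∀ p → [] ≈ₚ + 0 ·ₚ p
  0·ₚ []      = []
  0·ₚ (a ∷ p) = []≈0∷ (0·ₚ p)

  1·ₚ : ∀ p → + 1 ·ₚ p ≡ p
  1·ₚ []      = refl
  1·ₚ (a ∷ p) = cong₂ _∷_ (ℤ.*-identityˡ a) (1·ₚ p)

  ·ₚ-distribˡ : ∀ a p q → a ·ₚ (p +ₚ q) ≡ a ·ₚ p +ₚ a ·ₚ q
  ·ₚ-distribˡ a []      q       = refl
  ·ₚ-distribˡ a (b ∷ p) []      = refl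
  ·ₚ-distribˡ a (b ∷ p) (c ∷ q) = cong₂ _∷_ (ℤ.*-distribˡ-+ a b c) (·ₚ-distribˡ a p q)

  ·ₚ-distribʳ : ∀ a b p → (a ℤ.+ b) ·ₚ p ≡ a ·ₚ p +ₚ b ·ₚ p
  ·ₚ-distribʳ a b []      = refl
  ·ₚ-distribʳ a b (c ∷ p) = cong₂ _∷_ (ℤ.*-distribʳ-+ c a b) (·ₚ-distribʳ a b p)

  ·ₚ-assoc : ∀ a b p → a ·ₚ (b ·ₚ p) ≡ (a ℤ.* b) ·ₚ p
  ·ₚ-assoc a b []      = refl
  ·ₚ-assoc a b (c ∷ p) = cong₂ _∷_ (sym (ℤ.*-assoc a b c)) (·ₚ-assoc a b p)

  *ₚ-zeroʳ : ∀ p → p *ₚ [] ≈ₚ []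
  *ₚ-zeroʳ []      = []
  *ₚ-zeroʳ (a ∷ p) = 0∷≈[] (*ₚ-zeroʳ p)

  0∷*ₚ : ∀ p q → (+ 0 ∷ p) *ₚ q ≈ₚ + 0 ∷ p *ₚ q
  0∷*ₚ p q = +ₚ-vanishingˡ (+ 0 ∷ p *ₚ q) (0·ₚ q)

  *ₚ-vanishingˡ : ∀ {z} q → [] ≈ₚ z → [] ≈ₚ z *ₚ q
  *ₚ-vanishingˡ q []        = []
  *ₚ-vanishingˡ q ([]≈0∷ {z} e) = ≈ₚ-trans ([]≈0∷ (*ₚ-vanishingˡ q e)) (≈ₚ-sym (0∷*ₚ z q))

  *ₚ-congˡ : ∀ {p p′} q → p ≈ₚ p′ → p *ₚ q ≈ₚ p′ *ₚ q
  *ₚ-congˡ q []           = []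
  *ₚ-congˡ q ([]≈0∷ e)    = *ₚ-vanishingˡ q ([]≈0∷ e)
  *ₚ-congˡ q (0∷≈[] e)    = ≈ₚ-sym (*ₚ-vanishingˡ q ([]≈0∷ (≈ₚ-sym e)))
  *ₚ-congˡ q (_∷_ {a} refl e) = +ₚ-congʳ (a ·ₚ q) (refl ∷ *ₚ-congˡ q e)

  *ₚ-congʳ : ∀ p {q q′} → q ≈ₚ q′ → p *ₚ q ≈ₚ p *ₚ q′
  *ₚ-congʳ []      e = []
  *ₚ-congʳ (a ∷ p) e = +ₚ-cong (·ₚ-cong a e) (refl ∷ *ₚ-congʳ p e)

  *ₚ-cong : ∀ {p p′ q q′} → p ≈ₚ p′ → q ≈ₚ q′ → p *ₚ q ≈ₚ p′ *ₚ q′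
  *ₚ-cong {p′ = p′} {q = q} e f = ≈ₚ-trans (*ₚ-congˡ q e) (*ₚ-congʳ p′ f)

  +ₚ-medial : ∀ p q r s → (p +ₚ q) +ₚ (r +ₚ s) ≡ (p +ₚ r) +ₚ (q +ₚ s)
  +ₚ-medial p q r s =
    trans (+ₚ-assoc p q (r +ₚ s))
      (trans (cong (p +ₚ_) (trans (sym (+ₚ-assoc q r s)) (trans (cong (_+ₚ s) (+ₚ-comm q r)) (+ₚ-assoc r q s))))
             (sym (+ₚ-assoc p r (q +ₚ s))))

  *ₚ-distribʳ : ∀ p q r → (p +ₚ q) *ₚ r ≈ₚ p *ₚ r +ₚ q *ₚ r
  *ₚ-distribʳ []      q       r = ≈ₚ-refl
  *ₚ-distribʳ (a ∷ p) []      r = ≈ₚ-reflexive (sym (+ₚ-identityʳ _))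
  *ₚ-distribʳ (a ∷ p) (b ∷ q) r = begin
    (a ℤ.+ b) ·ₚ r +ₚ (+ 0 ∷ (p +ₚ q) *ₚ r)
      ≈⟨ +ₚ-cong (≈ₚ-reflexive (·ₚ-distribʳ a b r)) (refl ∷ *ₚ-distribʳ p q r) ⟩
    (a ·ₚ r +ₚ b ·ₚ r) +ₚ ((+ 0 ∷ p *ₚ r) +ₚ (+ 0 ∷ q *ₚ r))
      ≡⟨ +ₚ-medial (a ·ₚ r) (b ·ₚ r) (+ 0 ∷ p *ₚ r) (+ 0 ∷ q *ₚ r) ⟩
    (a ∷ p) *ₚ r +ₚ (b ∷ q) *ₚ r ∎

  ·ₚ-*ₚ : ∀ a p q → a ·ₚ (p *ₚ q) ≈ₚ (a ·ₚ p) *ₚ q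
  ·ₚ-*ₚ a []      q = []
  ·ₚ-*ₚ a (b ∷ p) q = begin
    a ·ₚ (b ·ₚ q +ₚ (+ 0 ∷ p *ₚ q))          ≡⟨ ·ₚ-distribˡ a (b ·ₚ q) (+ 0 ∷ p *ₚ q) ⟩
    a ·ₚ (b ·ₚ q) +ₚ (a ℤ.* + 0 ∷ a ·ₚ (p *ₚ q))
      ≈⟨ +ₚ-cong (≈ₚ-reflexive (·ₚ-assoc a b q)) (ℤ.*-zeroʳ a ∷ ·ₚ-*ₚ a p q) ⟩
    (a ℤ.* b) ·ₚ q +ₚ (+ 0 ∷ (a ·ₚ p) *ₚ q) ∎

  *ₚ-consʳ : ∀ p a q → p *ₚ (a ∷ q) ≈ₚ a ·ₚ p +ₚ (+ 0 ∷ p *ₚ q)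
  *ₚ-consʳ []      a q = []≈0∷ []
  *ₚ-consʳ (b ∷ p) a q = begin
    (b ℤ.* a ∷ b ·ₚ q) +ₚ (+ 0 ∷ p *ₚ (a ∷ q))
      ≈⟨ +ₚ-congʳ (b ℤ.* a ∷ b ·ₚ q) (refl ∷ *ₚ-consʳ p a q) ⟩
    (b ℤ.* a ∷ b ·ₚ q) +ₚ (+ 0 ∷ (a ·ₚ p +ₚ (+ 0 ∷ p *ₚ q)))
      ≈⟨ cong (ℤ._+ + 0) (ℤ.*-comm b a) ∷ ≈ₚ-reflexive (swap (b ·ₚ q) (a ·ₚ p) (+ 0 ∷ p *ₚ q)) ⟩
    (a ℤ.* b ∷ a ·ₚ p) +ₚ (+ 0 ∷ (b ·ₚ q +ₚ (+ 0 ∷ p *ₚ q))) ∎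
    where
    swap : ∀ x y z → x +ₚ (y +ₚ z) ≡ y +ₚ (x +ₚ z)
    swap x y z = trans (sym (+ₚ-assoc x y z)) (trans (cong (_+ₚ z) (+ₚ-comm x y)) (+ₚ-assoc y x z))

  *ₚ-comm : ∀ p q → p *ₚ q ≈ₚ q *ₚ p
  *ₚ-comm []      q = ≈ₚ-sym (*ₚ-zeroʳ q)
  *ₚ-comm (a ∷ p) q = begin
    a ·ₚ q +ₚ (+ 0 ∷ p *ₚ q) ≈⟨ +ₚ-congʳ (a ·ₚ q) (refl ∷ *ₚ-comm p q) ⟩
    a ·ₚ q +ₚ (+ 0 ∷ q *ₚ p) ≈⟨ ≈ₚ-sym (*ₚ-consʳ q a p) ⟩
    q *ₚ (a ∷ p)             ∎

  *ₚ-assoc : ∀ p q r → (p *ₚ q) *ₚ r ≈ₚ p *ₚ (q *ₚ r)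
  *ₚ-assoc []      q r = []
  *ₚ-assoc (a ∷ p) q r = begin
    (a ·ₚ q +ₚ (+ 0 ∷ p *ₚ q)) *ₚ r       ≈⟨ *ₚ-distribʳ (a ·ₚ q) (+ 0 ∷ p *ₚ q) r ⟩
    (a ·ₚ q) *ₚ r +ₚ (+ 0 ∷ p *ₚ q) *ₚ r
      ≈⟨ +ₚ-cong (≈ₚ-sym (·ₚ-*ₚ a q r)) (≈ₚ-trans (0∷*ₚ (p *ₚ q) r) (refl ∷ *ₚ-assoc p q r)) ⟩
    a ·ₚ (q *ₚ r) +ₚ (+ 0 ∷ p *ₚ (q *ₚ r)) ∎

  *ₚ-identityˡ : ∀ p → 1ₚ *ₚ p ≈ₚ p
  *ₚ-identityˡ p = begin
    + 1 ·ₚ p +ₚ (+ 0 ∷ []) ≡⟨ cong (_+ₚ (+ 0 ∷ [])) (1·ₚ p) ⟩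
    p +ₚ (+ 0 ∷ [])        ≈⟨ +ₚ-congʳ p (0∷≈[] []) ⟩
    p +ₚ []                ≡⟨ +ₚ-identityʳ p ⟩
    p                      ∎

  *ₚ-distribˡ : ∀ p q r → p *ₚ (q +ₚ r) ≈ₚ p *ₚ q +ₚ p *ₚ r
  *ₚ-distribˡ p q r = begin
    p *ₚ (q +ₚ r)     ≈⟨ *ₚ-comm p (q +ₚ r) ⟩
    (q +ₚ r) *ₚ p     ≈⟨ *ₚ-distribʳ q r p ⟩
    q *ₚ p +ₚ r *ₚ p  ≈⟨ +ₚ-cong (*ₚ-comm q p) (*ₚ-comm r p) ⟩
    p *ₚ q +ₚ p *ₚ r  ∎

  ℤ[X]-isCommutativeRing : IsCommutativeRing _≈ₚ_ _+ₚ_ _*ₚ_ -ₚ_ [] 1ₚ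
  ℤ[X]-isCommutativeRing = record
    { isRing = record
      { +-isAbelianGroup = record
        { isGroup = record
          { isMonoid = record
            { isSemigroup = record
              { isMagma = record { isEquivalence = ≈ₚ-isEquivalence ; ∙-cong = +ₚ-cong }
              ; assoc   = λ p q r → ≈ₚ-reflexive (+ₚ-assoc p q r) }
            ; identity = (λ p → ≈ₚ-refl) , (λ p → ≈ₚ-reflexive (+ₚ-identityʳ p)) }
          ; inverse = +ₚ-inverseˡ , +ₚ-inverseʳ
          ; ⁻¹-cong = -ₚ-cong }
        ; comm = λ p q → ≈ₚ-reflexive (+ₚ-comm p q) }
      ; *-cong     = *ₚ-cong
      ; *-assoc    = *ₚ-assoc
      ; *-identity = *ₚ-identityˡ , (λ p → ≈ₚ-trans (*ₚ-comm p 1ₚ) (*ₚ-identityˡ p))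
      ; distrib    = *ₚ-distribˡ , (λ r p q → *ₚ-distribʳ p q r) }
    ; *-comm = *ₚ-comm }

  ℤ[X] : CommutativeRing _ _
  ℤ[X] = record { isCommutativeRing = ℤ[X]-isCommutativeRing }

  const : ℤ → Poly
  const a = a ∷ []

  const-homomorphism : ℤ.+-*-rawRing -Raw-AlmostCommutative⟶ fromCommutativeRing ℤ[X]
  const-homomorphism = record
    { ⟦_⟧    = const
    ; +-homo = λ a b → ≈ₚ-refl
    ; *-homo = λ a b → sym (ℤ.+-identityʳ (a ℤ.* b)) ∷ []
    ; -‿homo = λ a → ≈ₚ-refl
    ; 0-homo = 0∷≈[] []
    ; 1-homo = ≈ₚ-refl }

  const-≟ : ∀ a b → Maybe (const a ≈ₚ const b)
  const-≟ a b with a ℤ.≟ b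
  ... | yes refl = just ≈ₚ-refl
  ... | no _     = nothing

  module ℤ[X]-Solver = Algebra.Solver.Ring ℤ.+-*-rawRing (fromCommutativeRing ℤ[X]) const-homomorphism const-≟

  open ℤ[X]-Solver using (solve; _:+_; _:*_; _:-_; :-_; _:=_; con)
  open import Algebra.Definitions.RawMagma (CommutativeRing.*-rawMagma ℤ[X]) using (_,_; _∣ʳ_) renaming (_∣_ to _∣ₚ_)
  open _∣ʳ_ using (quotient; equality)

  -- X^n - 1

  infixl 6 _-ₚ_
  _-ₚ_ : Poly → Poly → Poly
  p -ₚ q = p +ₚ -ₚ q

  X : Poly
  X = + 0 ∷ 1ₚ

  infix 8 X^_
  X^_ : ℕ → Poly
  X^ zero  = 1ₚ
  X^ suc n = X *ₚ X^ n

  X^-+ : ∀ a b → X^ (a ℕ.+ b) ≈ₚ X^ a *ₚ X^ b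
  X^-+ zero    b = ≈ₚ-sym (*ₚ-identityˡ (X^ b))
  X^-+ (suc a) b = begin
    X *ₚ X^ (a ℕ.+ b)     ≈⟨ *ₚ-congʳ X (X^-+ a b) ⟩
    X *ₚ (X^ a *ₚ X^ b)   ≈⟨ ≈ₚ-sym (*ₚ-assoc X (X^ a) (X^ b)) ⟩
    (X *ₚ X^ a) *ₚ X^ b   ∎

  X^-1-+ : ∀ a b → X^ (a ℕ.+ b) -ₚ 1ₚ ≈ₚ X^ a *ₚ (X^ b -ₚ 1ₚ) +ₚ (X^ a -ₚ 1ₚ)
  X^-1-+ a b = begin
    X^ (a ℕ.+ b) -ₚ 1ₚ       ≈⟨ +ₚ-congˡ (-ₚ 1ₚ) (X^-+ a b) ⟩
    X^ a *ₚ X^ b -ₚ 1ₚ       ≈⟨ solve 2 (λ A B → A :* B :- con (+ 1) := A :* (B :- con (+ 1)) :+ (A :- con (+ 1))) ≈ₚ-refl (X^ a) (X^ b) ⟩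
    X^ a *ₚ (X^ b -ₚ 1ₚ) +ₚ (X^ a -ₚ 1ₚ) ∎

  geom : ℕ → ℕ → Poly
  geom d zero    = []
  geom d (suc t) = 1ₚ +ₚ X^ d *ₚ geom d t

  geom-* : ∀ d t → geom d t *ₚ (X^ d -ₚ 1ₚ) ≈ₚ X^ (d ℕ.* t) -ₚ 1ₚ
  geom-* d zero    = subst (λ n → [] ≈ₚ X^ n -ₚ 1ₚ) (sym (ℕ.*-zeroʳ d)) ([]≈0∷ [])
  geom-* d (suc t) = begin
    (1ₚ +ₚ X^ d *ₚ geom d t) *ₚ (X^ d -ₚ 1ₚ)
      ≈⟨ solve 2 (λ Y G → (con (+ 1) :+ Y :* G) :* (Y :- con (+ 1)) := Y :* (G :* (Y :- con (+ 1))) :+ (Y :- con (+ 1)))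
               ≈ₚ-refl (X^ d) (geom d t) ⟩
    X^ d *ₚ (geom d t *ₚ (X^ d -ₚ 1ₚ)) +ₚ (X^ d -ₚ 1ₚ)
      ≈⟨ +ₚ-congˡ (X^ d -ₚ 1ₚ) (*ₚ-congʳ (X^ d) (geom-* d t)) ⟩
    X^ d *ₚ (X^ (d ℕ.* t) -ₚ 1ₚ) +ₚ (X^ d -ₚ 1ₚ)
      ≈⟨ ≈ₚ-sym (X^-1-+ d (d ℕ.* t)) ⟩
    X^ (d ℕ.+ d ℕ.* t) -ₚ 1ₚ
      ≡⟨ cong (λ n → X^ n -ₚ 1ₚ) (sym (ℕ.*-suc d t)) ⟩
    X^ (d ℕ.* suc t) -ₚ 1ₚ ∎

  geom-mod : ∀ d t → ∃ λ W → geom d t ≈ₚ W *ₚ (X^ d -ₚ 1ₚ) +ₚ const (+ t)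
  geom-mod d zero    = [] , []≈0∷ []
  geom-mod d (suc t) with geom-mod d t
  ... | W , eq = X^ d *ₚ W +ₚ const (+ t) , (begin
    1ₚ +ₚ X^ d *ₚ geom d t
      ≈⟨ +ₚ-congʳ 1ₚ (*ₚ-congʳ (X^ d) eq) ⟩
    1ₚ +ₚ X^ d *ₚ (W *ₚ (X^ d -ₚ 1ₚ) +ₚ const (+ t))
      ≈⟨ solve 3 (λ Y W T → con (+ 1) :+ Y :* (W :* (Y :- con (+ 1)) :+ T)
                            := (Y :* W :+ T) :* (Y :- con (+ 1)) :+ (con (+ 1) :+ T))
               ≈ₚ-refl (X^ d) W (const (+ t)) ⟩
    (X^ d *ₚ W +ₚ const (+ t)) *ₚ (X^ d -ₚ 1ₚ) +ₚ const (+ suc t) ∎)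

  X^-1-∣ : ∀ {d e} → d ℕ.∣ e → (X^ d -ₚ 1ₚ) ∣ₚ (X^ e -ₚ 1ₚ)
  X^-1-∣ {d} (divides t refl) = geom d t , ≈ₚ-trans (geom-* d t) (≈ₚ-reflexive (cong (λ n → X^ n -ₚ 1ₚ) (ℕ.*-comm d t)))

  X^-1-combination : ∀ {d e g} x y → g ℕ.+ e ℕ.* y ≡ d ℕ.* x →
    geom d x *ₚ (X^ d -ₚ 1ₚ) -ₚ X^ g *ₚ (geom e y *ₚ (X^ e -ₚ 1ₚ)) ≈ₚ X^ g -ₚ 1ₚ
  X^-1-combination {d} {e} {g} x y eq = begin
    geom d x *ₚ (X^ d -ₚ 1ₚ) -ₚ X^ g *ₚ (geom e y *ₚ (X^ e -ₚ 1ₚ))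
      ≈⟨ +ₚ-cong (geom-* d x) (-ₚ-cong (*ₚ-congʳ (X^ g) (geom-* e y))) ⟩
    X^ (d ℕ.* x) -ₚ 1ₚ -ₚ X^ g *ₚ (X^ (e ℕ.* y) -ₚ 1ₚ)
      ≡⟨ cong (λ n → X^ n -ₚ 1ₚ -ₚ X^ g *ₚ (X^ (e ℕ.* y) -ₚ 1ₚ)) (sym eq) ⟩
    X^ (g ℕ.+ e ℕ.* y) -ₚ 1ₚ -ₚ X^ g *ₚ (X^ (e ℕ.* y) -ₚ 1ₚ)
      ≈⟨ +ₚ-congˡ (-ₚ (X^ g *ₚ (X^ (e ℕ.* y) -ₚ 1ₚ))) (X^-1-+ g (e ℕ.* y)) ⟩
    X^ g *ₚ (X^ (e ℕ.* y) -ₚ 1ₚ) +ₚ (X^ g -ₚ 1ₚ) -ₚ X^ g *ₚ (X^ (e ℕ.* y) -ₚ 1ₚ)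
      ≈⟨ solve 2 (λ A B → A :+ B :- A := B) ≈ₚ-refl (X^ g *ₚ (X^ (e ℕ.* y) -ₚ 1ₚ)) (X^ g -ₚ 1ₚ) ⟩
    X^ g -ₚ 1ₚ ∎

  X^-1-bezout : ∀ d e → ∃₂ λ U V → U *ₚ (X^ d -ₚ 1ₚ) +ₚ V *ₚ (X^ e -ₚ 1ₚ) ≈ₚ X^ gcd d e -ₚ 1ₚ
  X^-1-bezout d e with Bézout.identity (gcd-GCD d e)
  ... | Bézout.+- x y eq = geom d x , -ₚ (X^ gcd d e *ₚ geom e y) , (begin
    geom d x *ₚ (X^ d -ₚ 1ₚ) +ₚ -ₚ (X^ gcd d e *ₚ geom e y) *ₚ (X^ e -ₚ 1ₚ)
      ≈⟨ solve 5 (λ G D E Y P → G :* D :+ (:- (Y :* P)) :* E := G :* D :- Y :* (P :* E)) ≈ₚ-refl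
           (geom d x) (X^ d -ₚ 1ₚ) (X^ e -ₚ 1ₚ) (X^ gcd d e) (geom e y) ⟩
    geom d x *ₚ (X^ d -ₚ 1ₚ) -ₚ X^ gcd d e *ₚ (geom e y *ₚ (X^ e -ₚ 1ₚ))
      ≈⟨ X^-1-combination {g = gcd d e} x y (trans (cong (gcd d e ℕ.+_) (ℕ.*-comm e y)) (trans eq (ℕ.*-comm x d))) ⟩
    X^ gcd d e -ₚ 1ₚ ∎)
  ... | Bézout.-+ x y eq = -ₚ (X^ gcd d e *ₚ geom d x) , geom e y , (begin
    -ₚ (X^ gcd d e *ₚ geom d x) *ₚ (X^ d -ₚ 1ₚ) +ₚ geom e y *ₚ (X^ e -ₚ 1ₚ)
      ≈⟨ solve 5 (λ G D E Y P → (:- (Y :* P)) :* D :+ G :* E := G :* E :- Y :* (P :* D)) ≈ₚ-refl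
           (geom e y) (X^ d -ₚ 1ₚ) (X^ e -ₚ 1ₚ) (X^ gcd d e) (geom d x) ⟩
    geom e y *ₚ (X^ e -ₚ 1ₚ) -ₚ X^ gcd d e *ₚ (geom d x *ₚ (X^ d -ₚ 1ₚ))
      ≈⟨ X^-1-combination {g = gcd d e} y x (trans (cong (gcd d e ℕ.+_) (ℕ.*-comm d x)) (trans eq (ℕ.*-comm y e))) ⟩
    X^ gcd d e -ₚ 1ₚ ∎)

  -- Monic polynomials and long division

  length-∷ʳ : ∀ (w : Poly) c → length (w ++ [ c ]) ≡ suc (length w)
  length-∷ʳ w c = trans (List.length-++ w) (ℕ.+-comm (length w) 1)

  Monic : Poly → Set
  Monic p = ∃ λ m → p ≡ m ++ [ + 1 ]

  +ₚ-∷ʳ : ∀ p w c → length p ≤ length w → ∃ λ v → p +ₚ (w ++ [ c ]) ≡ v ++ [ c ] × length v ≡ length w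
  +ₚ-∷ʳ []      w       c p≤w       = w , refl , refl
  +ₚ-∷ʳ (a ∷ p) (b ∷ w) c (s≤s p≤w) with +ₚ-∷ʳ p w c p≤w
  ... | v , eq , len = a ℤ.+ b ∷ v , cong (a ℤ.+ b ∷_) eq , cong suc len

  1ₚ*ₚ∷ʳ : ∀ y c → 1ₚ *ₚ (y ++ [ c ]) ≡ y ++ [ c ]
  1ₚ*ₚ∷ʳ []      c = cong [_] (trans (ℤ.+-identityʳ _) (ℤ.*-identityˡ c))
  1ₚ*ₚ∷ʳ (b ∷ y) c = cong₂ _∷_ (trans (ℤ.+-identityʳ _) (ℤ.*-identityˡ b)) (trans (+ₚ-identityʳ _) (1·ₚ (y ++ [ c ])))

  *ₚ-monic-∷ʳ : ∀ m y c → ∃ λ w → (m ++ [ + 1 ]) *ₚ (y ++ [ c ]) ≡ w ++ [ c ] × length w ≡ length m ℕ.+ length y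
  *ₚ-monic-∷ʳ []      y c = y , 1ₚ*ₚ∷ʳ y c , refl
  *ₚ-monic-∷ʳ (a ∷ m) y c with *ₚ-monic-∷ʳ m y c
  ... | w′ , eq′ , len′ with +ₚ-∷ʳ (a ·ₚ (y ++ [ c ])) (+ 0 ∷ w′) c
        (subst (_≤ suc (length w′)) (sym (trans (List.length-map (a ℤ.*_) (y ++ [ c ])) (length-∷ʳ y c)))
               (s≤s (subst (length y ≤_) (sym len′) (ℕ.m≤n+m (length y) (length m)))))
  ... | w , eq , len = w , trans (cong (λ z → a ·ₚ (y ++ [ c ]) +ₚ (+ 0 ∷ z)) eq′) eq , trans len (cong suc len′)

  Monic-*ₚ : ∀ {p q} → Monic p → Monic q → Monic (p *ₚ q)
  Monic-*ₚ (m , refl) (y , refl) with *ₚ-monic-∷ʳ m y (+ 1)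
  ... | w , eq , _ = w , eq

  ≈ₚ-[]⊎∷ʳ : ∀ p → p ≈ₚ [] ⊎ ∃₂ λ w c → c ≢ + 0 × p ≈ₚ w ++ [ c ]
  ≈ₚ-[]⊎∷ʳ []      = inj₁ []
  ≈ₚ-[]⊎∷ʳ (a ∷ p) with ≈ₚ-[]⊎∷ʳ p
  ... | inj₂ (w , c , c≢0 , eq) = inj₂ (a ∷ w , c , c≢0 , refl ∷ eq)
  ... | inj₁ eq with a ℤ.≟ + 0
  ...   | yes refl = inj₁ (0∷≈[] eq)
  ...   | no a≢0   = inj₂ ([] , a , a≢0 , refl ∷ eq)

  ∷ʳ-length-≤ : ∀ {c} w {q} → c ≢ + 0 → w ++ [ c ] ≈ₚ q → length (w ++ [ c ]) ≤ length q
  ∷ʳ-length-≤ []      c≢0 (0∷≈[] _) = ⊥-elim (c≢0 refl)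
  ∷ʳ-length-≤ []      c≢0 (_ ∷ _)   = s≤s z≤n
  ∷ʳ-length-≤ {c} (a ∷ w) c≢0 (0∷≈[] eq) with ∷ʳ-length-≤ w c≢0 eq
  ... | le = ⊥-elim (ℕ.<⇒≱ (subst (0 <_) (sym (length-∷ʳ w c)) (s≤s z≤n)) le)
  ∷ʳ-length-≤ (a ∷ w) c≢0 (_ ∷ eq)   = s≤s (∷ʳ-length-≤ w c≢0 eq)

  monic-*ₚ-short⇒≈[] : ∀ m {Y R} → (m ++ [ + 1 ]) *ₚ Y ≈ₚ R → length R ≤ length m → Y ≈ₚ []
  monic-*ₚ-short⇒≈[] m {Y} {R} eq short with ≈ₚ-[]⊎∷ʳ Y
  ... | inj₁ Y≈0 = Y≈0
  ... | inj₂ (w , c , c≢0 , Y≈) with *ₚ-monic-∷ʳ m w c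
  ... | v , prod≡ , len = ⊥-elim (ℕ.<⇒≱ (s≤s (ℕ.m≤m+n (length m) (length w))) (ℕ.≤-trans long short))
    where
    long : suc (length m ℕ.+ length w) ≤ length R
    long = subst (_≤ length R) (trans (length-∷ʳ v c) (cong suc len))
             (∷ʳ-length-≤ v c≢0 (≈ₚ-trans (≈ₚ-sym (≈ₚ-reflexive prod≡)) (≈ₚ-trans (*ₚ-congʳ (m ++ [ + 1 ]) (≈ₚ-sym Y≈)) eq)))

  ∷≈ₚ[]⁻¹ : ∀ {a p} → a ∷ p ≈ₚ [] → a ≡ + 0 × p ≈ₚ []
  ∷≈ₚ[]⁻¹ (0∷≈[] eq) = refl , eq

  ·ₚ-cancel : ∀ {c} r → c ≢ + 0 → c ·ₚ r ≈ₚ [] → r ≈ₚ []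
  ·ₚ-cancel []      c≢0 eq = []
  ·ₚ-cancel {c} (a ∷ r) c≢0 eq with ∷≈ₚ[]⁻¹ eq
  ... | ca≡0 , eq′ with ℤ.i*j≡0⇒i≡0∨j≡0 c ca≡0
  ...   | inj₁ c≡0 = ⊥-elim (c≢0 c≡0)
  ...   | inj₂ refl = 0∷≈[] (·ₚ-cancel r c≢0 eq′)

  ≈ₚ-by-difference : ∀ {A B} → A -ₚ B ≈ₚ [] → A ≈ₚ B
  ≈ₚ-by-difference {A} {B} eq = begin
    A              ≈⟨ solve 2 (λ A B → A := (A :- B) :+ B) ≈ₚ-refl A B ⟩
    (A -ₚ B) +ₚ B  ≈⟨ +ₚ-congˡ B eq ⟩
    B              ∎

  *ₚ-cancelʳ-monic : ∀ {M A B} → Monic M → A *ₚ M ≈ₚ B *ₚ M → A ≈ₚ B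
  *ₚ-cancelʳ-monic {_} {A} {B} (m , refl) eq = ≈ₚ-by-difference (monic-*ₚ-short⇒≈[] m M*[A-B]≈0 z≤n)
    where
    M : Poly
    M = m ++ [ + 1 ]
    M*[A-B]≈0 : M *ₚ (A -ₚ B) ≈ₚ []
    M*[A-B]≈0 = begin
      M *ₚ (A -ₚ B)           ≈⟨ solve 3 (λ M A B → M :* (A :- B) := A :* M :- B :* M) ≈ₚ-refl M A B ⟩
      A *ₚ M -ₚ B *ₚ M        ≈⟨ +ₚ-congˡ (-ₚ (B *ₚ M)) eq ⟩
      B *ₚ M -ₚ B *ₚ M        ≈⟨ +ₚ-inverseʳ (B *ₚ M) ⟩
      []                      ∎

  -- Public copies of Defs' private helpers of divMonic: long division of coefficient lists
  -- written highest degree first, by a monic divisor given without its leading 1.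
  subtractFront : List ℤ → List ℤ → List ℤ
  subtractFront (x ∷ xs) (y ∷ ys) = (x ℤ.- y) ∷ subtractFront xs ys
  subtractFront xs       _        = xs

  longDivision : ℕ → List ℤ → List ℤ → List ℤ
  longDivision zero    _          _  = []
  longDivision (suc k) []         gT = []
  longDivision (suc k) (a ∷ rest) gT =
    if length rest <ᵇ length gT then []
    else a ∷ longDivision k (subtractFront rest (map (a ℤ.*_) gT)) gT

  longDivision-unique :
    ∀ {D : ℕ → List ℤ → List ℤ → List ℤ} {T : ℤ → List ℤ → List ℤ → List ℤ} →
    (∀ a ys → T a [] ys ≡ []) →
    (∀ a x xs → T a (x ∷ xs) [] ≡ x ∷ xs) →
    (∀ a x xs y ys → T a (x ∷ xs) (y ∷ ys) ≡ (x ℤ.- a ℤ.* y) ∷ T a xs ys) →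
    (∀ l gT → D zero l gT ≡ []) →
    (∀ k gT → D (suc k) [] gT ≡ []) →
    (∀ k a rest gT → D (suc k) (a ∷ rest) gT ≡
       (if length rest <ᵇ length gT then [] else a ∷ D k (T a rest gT) gT)) →
    ∀ k l gT → D k l gT ≡ longDivision k l gT
  longDivision-unique {D} {T} t₁ t₂ t₃ d₁ d₂ d₃ = go
    where
    T-unique : ∀ a xs ys → T a xs ys ≡ subtractFront xs (map (a ℤ.*_) ys)
    T-unique a []       ys       = t₁ a ys
    T-unique a (x ∷ xs) []       = t₂ a x xs
    T-unique a (x ∷ xs) (y ∷ ys) = trans (t₃ a x xs y ys) (cong ((x ℤ.- a ℤ.* y) ∷_) (T-unique a xs ys))

    go : ∀ k l gT → D k l gT ≡ longDivision k l gT
    go zero    l          gT = d₁ l gT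
    go (suc k) []         gT = d₂ k gT
    go (suc k) (a ∷ rest) gT = trans (d₃ k a rest gT)
      (cong (λ q → if length rest <ᵇ length gT then [] else a ∷ q)
            (trans (go k _ gT) (cong (λ r → longDivision k r gT) (T-unique a rest gT))))

  -- `with` generalises the arguments of Defs' private helpers to variables, so that
  -- unification can solve the metavariables below to those helpers.
  mutual
    private
      divHL′ : ℕ → List ℤ → List ℤ → List ℤ
      divHL′ = _
      subFront′ : ℤ → List ℤ → List ℤ → List ℤ
      subFront′ = _

    divMonic-unfold : ∀ f g → divMonic f g ≡ reverse (longDivision (length f) (reverse f) (drop 1 (reverse g)))
    divMonic-unfold f g with length f | reverse {A = ℤ}
    ... | k | rev with rev f | drop 1 (rev g)
    ... | l | gT = cong rev (longDivision-unique {divHL′} {subFront′} (λ _ _ → refl) (λ _ _ _ → refl) (λ _ _ _ _ _ → refl)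
                                                (λ _ _ → refl) (λ _ _ → refl) (λ _ _ _ _ → refl) k l gT)

  X*ₚ : ∀ p → X *ₚ p ≈ₚ + 0 ∷ p
  X*ₚ p = ≈ₚ-trans (+ₚ-vanishingˡ (+ 0 ∷ 1ₚ *ₚ p) (0·ₚ p)) (refl ∷ *ₚ-identityˡ p)

  const*ₚ : ∀ a p → const a *ₚ p ≈ₚ a ·ₚ p
  const*ₚ a p = ≈ₚ-trans (+ₚ-congʳ (a ·ₚ p) (0∷≈[] [])) (≈ₚ-reflexive (+ₚ-identityʳ (a ·ₚ p)))

  ∷ʳ≈ₚ : ∀ xs a → xs ++ [ a ] ≈ₚ xs +ₚ const a *ₚ X^ length xs
  ∷ʳ≈ₚ []       a = sym (trans (ℤ.+-identityʳ _) (ℤ.*-identityʳ a)) ∷ []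
  ∷ʳ≈ₚ (x ∷ xs) a = begin
    x ∷ (xs ++ [ a ])                       ≈⟨ sym (ℤ.+-identityʳ x) ∷ ∷ʳ≈ₚ xs a ⟩
    (x ∷ xs) +ₚ (+ 0 ∷ const a *ₚ X^ n)      ≈⟨ +ₚ-congʳ (x ∷ xs) (≈ₚ-sym (X*ₚ (const a *ₚ X^ n))) ⟩
    (x ∷ xs) +ₚ X *ₚ (const a *ₚ X^ n)
      ≈⟨ +ₚ-congʳ (x ∷ xs) (solve 3 (λ X A Y → X :* (A :* Y) := A :* (X :* Y)) ≈ₚ-refl X (const a) (X^ n)) ⟩
    (x ∷ xs) +ₚ const a *ₚ X^ suc n          ∎
    where
    n : ℕ
    n = length xs

  descending : List ℤ → Poly
  descending []      = []
  descending (a ∷ l) = descending l +ₚ const a *ₚ X^ length l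

  reverse≈descending : ∀ l → reverse l ≈ₚ descending l
  reverse≈descending []      = []
  reverse≈descending (a ∷ l) = begin
    reverse (a ∷ l)                                 ≡⟨ List.unfold-reverse a l ⟩
    reverse l ++ [ a ]                              ≈⟨ ∷ʳ≈ₚ (reverse l) a ⟩
    reverse l +ₚ const a *ₚ X^ length (reverse l)   ≈⟨ +ₚ-cong (reverse≈descending l)
                                                          (≈ₚ-reflexive (cong (λ n → const a *ₚ X^ n) (List.length-reverse l))) ⟩
    descending l +ₚ const a *ₚ X^ length l          ∎

  descending-map : ∀ a ys → descending (map (a ℤ.*_) ys) ≈ₚ const a *ₚ descending ys
  descending-map a []       = ≈ₚ-sym (*ₚ-zeroʳ (const a))
  descending-map a (y ∷ ys) = begin
    descending (map (a ℤ.*_) ys) +ₚ const (a ℤ.* y) *ₚ X^ length (map (a ℤ.*_) ys)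
      ≡⟨ cong (λ n → descending (map (a ℤ.*_) ys) +ₚ const (a ℤ.* y) *ₚ X^ n) (List.length-map (a ℤ.*_) ys) ⟩
    descending (map (a ℤ.*_) ys) +ₚ const (a ℤ.* y) *ₚ X^ length ys
      ≈⟨ +ₚ-cong (descending-map a ys) (*ₚ-congˡ (X^ length ys) (sym (ℤ.+-identityʳ (a ℤ.* y)) ∷ [])) ⟩
    const a *ₚ descending ys +ₚ (const a *ₚ const y) *ₚ X^ length ys
      ≈⟨ solve 4 (λ A B Y Z → A :* B :+ (A :* Y) :* Z := A :* (B :+ Y :* Z)) ≈ₚ-refl (const a) (descending ys) (const y) (X^ length ys) ⟩
    const a *ₚ descending (y ∷ ys) ∎

  length-subtractFront : ∀ xs ys → length (subtractFront xs ys) ≡ length xs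
  length-subtractFront []       ys       = refl
  length-subtractFront (x ∷ xs) []       = refl
  length-subtractFront (x ∷ xs) (y ∷ ys) = cong suc (length-subtractFront xs ys)

  subtractFront-descending : ∀ xs ys → length ys ≤ length xs →
    descending (subtractFront xs ys) +ₚ X^ (length xs ∸ length ys) *ₚ descending ys ≈ₚ descending xs
  subtractFront-descending []       []       _  = 0∷≈[] []
  subtractFront-descending (x ∷ xs) []       _  = ≈ₚ-trans (+ₚ-congʳ (descending (x ∷ xs)) (*ₚ-zeroʳ (X^ suc (length xs))))
                                                           (≈ₚ-reflexive (+ₚ-identityʳ _))
  subtractFront-descending (x ∷ xs) (y ∷ ys) (s≤s le) = begin
    (descending S +ₚ const (x ℤ.- y) *ₚ X^ length S) +ₚ X^ δ *ₚ (descending ys +ₚ const y *ₚ X^ length ys)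
      ≡⟨ cong (λ n → (descending S +ₚ const (x ℤ.- y) *ₚ X^ n) +ₚ X^ δ *ₚ (descending ys +ₚ const y *ₚ X^ length ys))
              (length-subtractFront xs ys) ⟩
    (descending S +ₚ const (x ℤ.- y) *ₚ Z) +ₚ X^ δ *ₚ (descending ys +ₚ const y *ₚ X^ length ys)
      ≈⟨ solve 7 (λ HS Cx Cy Z D HY W → (HS :+ (Cx :- Cy) :* Z) :+ D :* (HY :+ Cy :* W)
                                         := (HS :+ D :* HY) :+ Cx :* Z :+ Cy :* (D :* W :- Z))
           ≈ₚ-refl (descending S) (const x) (const y) Z (X^ δ) (descending ys) (X^ length ys) ⟩
    (descending S +ₚ X^ δ *ₚ descending ys) +ₚ const x *ₚ Z +ₚ const y *ₚ (X^ δ *ₚ X^ length ys -ₚ Z)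
      ≈⟨ +ₚ-cong (+ₚ-congˡ (const x *ₚ Z) (subtractFront-descending xs ys le))
                 (*ₚ-congʳ (const y) (+ₚ-congˡ (-ₚ Z) X^δ*X^ys≈Z)) ⟩
    descending xs +ₚ const x *ₚ Z +ₚ const y *ₚ (Z -ₚ Z)
      ≈⟨ solve 4 (λ A B C Z → A :+ B :* Z :+ C :* (Z :- Z) := A :+ B :* Z) ≈ₚ-refl (descending xs) (const x) (const y) Z ⟩
    descending (x ∷ xs) ∎
    where
    S : List ℤ
    S = subtractFront xs ys
    δ : ℕ
    δ = length xs ∸ length ys
    Z : Poly
    Z = X^ length xs
    X^δ*X^ys≈Z : X^ δ *ₚ X^ length ys ≈ₚ Z
    X^δ*X^ys≈Z = ≈ₚ-trans (≈ₚ-sym (X^-+ δ (length ys))) (≈ₚ-reflexive (cong X^_ (ℕ.m∸n+n≡m le)))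

  module LongDivision (m : Poly) where

    private
      L : ℕ
      L = length m
      gT : List ℤ
      gT = reverse m
      g : Poly
      g = m ++ [ + 1 ]

      length-gT : length gT ≡ L
      length-gT = List.length-reverse m

      g≈ : g ≈ₚ descending gT +ₚ X^ L
      g≈ = begin
        m ++ [ + 1 ]                               ≡⟨ sym (List.reverse-involutive g) ⟩
        reverse (reverse g)                        ≡⟨ cong reverse (List.reverse-++ m [ + 1 ]) ⟩
        reverse (+ 1 ∷ gT)                         ≈⟨ reverse≈descending (+ 1 ∷ gT) ⟩
        descending gT +ₚ const (+ 1) *ₚ X^ length gT ≈⟨ +ₚ-congʳ (descending gT) (*ₚ-identityˡ (X^ length gT)) ⟩
        descending gT +ₚ X^ length gT              ≡⟨ cong (λ n → descending gT +ₚ X^ n) length-gT ⟩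
        descending gT +ₚ X^ L                      ∎

    division-step : ∀ a rest → L ≤ length rest →
      descending (a ∷ rest) ≈ₚ descending (subtractFront rest (map (a ℤ.*_) gT)) +ₚ (const a *ₚ X^ (length rest ∸ L)) *ₚ g
    division-step a rest L≤rest = begin
      descending rest +ₚ const a *ₚ X^ length rest
        ≈⟨ +ₚ-cong (≈ₚ-sym rest≈) (*ₚ-congʳ (const a) (≈ₚ-sym X^δ*X^L)) ⟩
      (descending rest′ +ₚ X^ δ *ₚ descending aG) +ₚ const a *ₚ (X^ δ *ₚ X^ L)
        ≈⟨ +ₚ-congˡ (const a *ₚ (X^ δ *ₚ X^ L)) (+ₚ-congʳ (descending rest′) (*ₚ-congʳ (X^ δ) (descending-map a gT))) ⟩
      (descending rest′ +ₚ X^ δ *ₚ (const a *ₚ descending gT)) +ₚ const a *ₚ (X^ δ *ₚ X^ L)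
        ≈⟨ solve 5 (λ R D A HG XL → (R :+ D :* (A :* HG)) :+ A :* (D :* XL) := R :+ (A :* D) :* (HG :+ XL))
             ≈ₚ-refl (descending rest′) (X^ δ) (const a) (descending gT) (X^ L) ⟩
      descending rest′ +ₚ (const a *ₚ X^ δ) *ₚ (descending gT +ₚ X^ L)
        ≈⟨ +ₚ-congʳ (descending rest′) (*ₚ-congʳ (const a *ₚ X^ δ) (≈ₚ-sym g≈)) ⟩
      descending rest′ +ₚ (const a *ₚ X^ δ) *ₚ g ∎
      where
      aG : List ℤ
      aG = map (a ℤ.*_) gT
      rest′ : List ℤ
      rest′ = subtractFront rest aG
      δ : ℕ
      δ = length rest ∸ L
      length-aG : length aG ≡ L
      length-aG = trans (List.length-map (a ℤ.*_) gT) length-gT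
      rest≈ : descending rest′ +ₚ X^ δ *ₚ descending aG ≈ₚ descending rest
      rest≈ = subst (λ n → descending rest′ +ₚ X^ (length rest ∸ n) *ₚ descending aG ≈ₚ descending rest) length-aG
                (subtractFront-descending rest aG (subst (_≤ length rest) (sym length-aG) L≤rest))
      X^δ*X^L : X^ δ *ₚ X^ L ≈ₚ X^ length rest
      X^δ*X^L = ≈ₚ-trans (≈ₚ-sym (X^-+ δ L)) (≈ₚ-reflexive (cong X^_ (ℕ.m∸n+n≡m L≤rest)))

    invariant : ∀ k l → length l ≤ k → ∃ λ r →
      length r ≤ L × descending l ≈ₚ descending (longDivision k l gT) *ₚ g +ₚ descending r
                   × length (longDivision k l gT) ≡ length l ∸ L
    invariant zero    []         _ = [] , z≤n , ≈ₚ-refl , sym (ℕ.0∸n≡0 L)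
    invariant (suc k) []         _ = [] , z≤n , ≈ₚ-refl , sym (ℕ.0∸n≡0 L)
    invariant (suc k) (a ∷ rest) (s≤s le) with length rest <ᵇ length gT in lt
    ... | true  = a ∷ rest , short , ≈ₚ-refl , sym (ℕ.m≤n⇒m∸n≡0 short)
      where
      short : suc (length rest) ≤ L
      short = subst (suc (length rest) ≤_) length-gT (ℕ.<ᵇ⇒< (length rest) (length gT) (subst T (sym lt) tt))
    ... | false with invariant k (subtractFront rest (map (a ℤ.*_) gT))
                       (subst (_≤ k) (sym (length-subtractFront rest (map (a ℤ.*_) gT))) le)
    ... | r , r-short , eq , len = r , r-short , step , length-q
      where
      q′ : List ℤ
      q′ = longDivision k (subtractFront rest (map (a ℤ.*_) gT)) gT
      L≤rest : L ≤ length rest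
      L≤rest = subst (_≤ length rest) length-gT (ℕ.≮⇒≥ (λ r<g → subst T lt (ℕ.<⇒<ᵇ r<g)))
      length-q′ : length q′ ≡ length rest ∸ L
      length-q′ = trans len (cong (_∸ L) (length-subtractFront rest (map (a ℤ.*_) gT)))
      length-q : suc (length q′) ≡ suc (length rest) ∸ L
      length-q = trans (cong suc length-q′) (sym (ℕ.+-∸-assoc 1 L≤rest))
      step : descending (a ∷ rest) ≈ₚ descending (a ∷ q′) *ₚ g +ₚ descending r
      step = begin
        descending (a ∷ rest)
          ≈⟨ division-step a rest L≤rest ⟩
        descending (subtractFront rest (map (a ℤ.*_) gT)) +ₚ (const a *ₚ X^ (length rest ∸ L)) *ₚ g
          ≈⟨ +ₚ-congˡ ((const a *ₚ X^ (length rest ∸ L)) *ₚ g) eq ⟩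
        (descending q′ *ₚ g +ₚ descending r) +ₚ (const a *ₚ X^ (length rest ∸ L)) *ₚ g
          ≡⟨ cong (λ n → (descending q′ *ₚ g +ₚ descending r) +ₚ (const a *ₚ X^ n) *ₚ g) (sym length-q′) ⟩
        (descending q′ *ₚ g +ₚ descending r) +ₚ (const a *ₚ X^ length q′) *ₚ g
          ≈⟨ solve 4 (λ Q G R A → (Q :* G :+ R) :+ A :* G := (Q :+ A) :* G :+ R) ≈ₚ-refl
               (descending q′) g (descending r) (const a *ₚ X^ length q′) ⟩
        descending (a ∷ q′) *ₚ g +ₚ descending r ∎

    leading : ∀ k a rest → suc (length rest) ≤ k → L ≤ length rest → ∃ λ q → longDivision k (a ∷ rest) gT ≡ a ∷ q
    leading (suc k) a rest _ L≤rest with length rest <ᵇ length gT in lt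
    ... | true  = ⊥-elim (ℕ.<⇒≱ (ℕ.<ᵇ⇒< (length rest) (length gT) (subst T (sym lt) tt))
                                (subst (_≤ length rest) (sym length-gT) L≤rest))
    ... | false = _ , refl

  divMonic-correct : ∀ f m → ∃ λ R → length R ≤ length m × f ≈ₚ divMonic f (m ++ [ + 1 ]) *ₚ (m ++ [ + 1 ]) +ₚ R
  divMonic-correct f m with LongDivision.invariant m (length f) (reverse f) (ℕ.≤-reflexive (List.length-reverse f))
  ... | r , r-short , eq , _ = reverse r , subst (_≤ length m) (sym (List.length-reverse r)) r-short , (begin
    f                                 ≡⟨ sym (List.reverse-involutive f) ⟩
    reverse (reverse f)               ≈⟨ reverse≈descending (reverse f) ⟩
    descending (reverse f)            ≈⟨ eq ⟩
    descending qs *ₚ g +ₚ descending r ≈⟨ +ₚ-cong (*ₚ-congˡ g (≈ₚ-sym (reverse≈descending qs))) (≈ₚ-sym (reverse≈descending r)) ⟩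
    reverse qs *ₚ g +ₚ reverse r      ≡⟨ cong (λ q → q *ₚ g +ₚ reverse r) (sym quotient≡) ⟩
    divMonic f g *ₚ g +ₚ reverse r    ∎)
    where
    g : Poly
    g = m ++ [ + 1 ]
    qs : List ℤ
    qs = longDivision (length f) (reverse f) (reverse m)
    quotient≡ : divMonic f g ≡ reverse qs
    quotient≡ = trans (divMonic-unfold f g)
                  (cong (λ gT → reverse (longDivision (length f) (reverse f) gT)) (cong (drop 1) (List.reverse-++ m [ + 1 ])))

  divMonic-exact : ∀ f m K → f ≈ₚ K *ₚ (m ++ [ + 1 ]) → divMonic f (m ++ [ + 1 ]) ≈ₚ K
  divMonic-exact f m K f≈ with divMonic-correct f m
  ... | R , R-short , f≈′ = ≈ₚ-sym (≈ₚ-by-difference (monic-*ₚ-short⇒≈[] m g*[K-q]≈R R-short))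
    where
    g : Poly
    g = m ++ [ + 1 ]
    q : Poly
    q = divMonic f g
    g*[K-q]≈R : g *ₚ (K -ₚ q) ≈ₚ R
    g*[K-q]≈R = begin
      g *ₚ (K -ₚ q)          ≈⟨ solve 3 (λ G K Q → G :* (K :- Q) := K :* G :- Q :* G) ≈ₚ-refl g K q ⟩
      K *ₚ g -ₚ q *ₚ g       ≈⟨ +ₚ-congˡ (-ₚ (q *ₚ g)) (≈ₚ-trans (≈ₚ-sym f≈) f≈′) ⟩
      q *ₚ g +ₚ R -ₚ q *ₚ g  ≈⟨ solve 2 (λ A R → A :+ R :- A := R) ≈ₚ-refl (q *ₚ g) R ⟩
      R                      ∎

  divMonic-monic : ∀ w m → length m ≤ length w → Monic (divMonic (w ++ [ + 1 ]) (m ++ [ + 1 ]))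
  divMonic-monic w m m≤w
    with LongDivision.leading m (length (w ++ [ + 1 ])) (+ 1) (reverse w)
           (ℕ.≤-reflexive (trans (cong suc (List.length-reverse w)) (sym (length-∷ʳ w (+ 1)))))
           (subst (length m ≤_) (sym (List.length-reverse w)) m≤w)
  ... | q , eq = reverse q , quotient≡
    where
    f : Poly
    f = w ++ [ + 1 ]
    quotient≡ : divMonic f (m ++ [ + 1 ]) ≡ reverse q ++ [ + 1 ]
    quotient≡ = trans (divMonic-unfold f (m ++ [ + 1 ]))
      (trans (cong reverse (trans (cong₂ (longDivision (length f)) (List.reverse-++ w [ + 1 ])
                                                                   (cong (drop 1) (List.reverse-++ m [ + 1 ])))
                                  eq))
             (List.unfold-reverse (+ 1) q))

  monic-∣-scaled : ∀ {M C c} → Monic M → c ≢ + 0 → M ∣ₚ const c *ₚ C → M ∣ₚ C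
  monic-∣-scaled {_} {C} {c} (m , refl) c≢0 (Q , Q*g≈cC) with divMonic-correct C m
  ... | R , R-short , C≈ = q , ≈ₚ-sym (begin
    C               ≈⟨ C≈ ⟩
    q *ₚ g +ₚ R     ≈⟨ +ₚ-congʳ (q *ₚ g) R≈0 ⟩
    q *ₚ g +ₚ []    ≡⟨ +ₚ-identityʳ (q *ₚ g) ⟩
    q *ₚ g          ∎)
    where
    g : Poly
    g = m ++ [ + 1 ]
    q : Poly
    q = divMonic C g
    g*[Q-cq]≈cR : g *ₚ (Q -ₚ const c *ₚ q) ≈ₚ c ·ₚ R
    g*[Q-cq]≈cR = begin
      g *ₚ (Q -ₚ const c *ₚ q)
        ≈⟨ solve 4 (λ G Q C q → G :* (Q :- C :* q) := Q :* G :- C :* (q :* G)) ≈ₚ-refl g Q (const c) q ⟩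
      Q *ₚ g -ₚ const c *ₚ (q *ₚ g)
        ≈⟨ +ₚ-congˡ (-ₚ (const c *ₚ (q *ₚ g))) (≈ₚ-trans Q*g≈cC (*ₚ-congʳ (const c) C≈)) ⟩
      const c *ₚ (q *ₚ g +ₚ R) -ₚ const c *ₚ (q *ₚ g)
        ≈⟨ solve 3 (λ C A R → C :* (A :+ R) :- C :* A := C :* R) ≈ₚ-refl (const c) (q *ₚ g) R ⟩
      const c *ₚ R
        ≈⟨ const*ₚ c R ⟩
      c ·ₚ R ∎
    Q-cq≈0 : Q -ₚ const c *ₚ q ≈ₚ []
    Q-cq≈0 = monic-*ₚ-short⇒≈[] m g*[Q-cq]≈cR (subst (_≤ length m) (sym (List.length-map (c ℤ.*_) R)) R-short)
    R≈0 : R ≈ₚ []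
    R≈0 = ·ₚ-cancel R c≢0 (≈ₚ-trans (≈ₚ-sym g*[Q-cq]≈cR) (≈ₚ-trans (*ₚ-congʳ g Q-cq≈0) (*ₚ-zeroʳ g)))

  ∣ₚ-length : ∀ {w c K} m → c ≢ + 0 → w ++ [ c ] ≈ₚ K *ₚ (m ++ [ + 1 ]) → length m ≤ length w
  ∣ₚ-length {w} {c} {K} m c≢0 eq = ℕ.≮⇒≥ too-short
    where
    too-short : ¬ length w < length m
    too-short w<m = ℕ.<⇒≱ (s≤s z≤n) (subst (_≤ 0) (length-∷ʳ w c) (∷ʳ-length-≤ w c≢0 w++c≈0))
      where
      K≈0 : K ≈ₚ []
      K≈0 = monic-*ₚ-short⇒≈[] m (≈ₚ-trans (*ₚ-comm (m ++ [ + 1 ]) K) (≈ₚ-sym eq))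
                             (subst (_≤ length m) (sym (length-∷ʳ w c)) w<m)
      w++c≈0 : w ++ [ c ] ≈ₚ []
      w++c≈0 = ≈ₚ-trans eq (*ₚ-congˡ (m ++ [ + 1 ]) K≈0)

  -- The factorisation X^n - 1 = ∏_{d ∣ n} Φ d

  open FilteredProduct (CommutativeRing.*-commutativeMonoid ℤ[X])

  selectDivisors : ℕ → ℕ → List Poly → List Poly
  selectDivisors m d []       = []
  selectDivisors m d (p ∷ ps) =
    if does (d ∣? m) then p ∷ selectDivisors m (suc d) ps else selectDivisors m (suc d) ps

  selectDivisors-unique :
    ∀ {F : ℕ → ℕ → List Poly → List Poly} →
    (∀ m d → F m d [] ≡ []) →
    (∀ m d p ps → F m d (p ∷ ps) ≡ (if does (d ∣? m) then p ∷ F m (suc d) ps else F m (suc d) ps)) →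
    ∀ m d ps → F m d ps ≡ selectDivisors m d ps
  selectDivisors-unique     nil cons m d []       = nil m d
  selectDivisors-unique {F} nil cons m d (p ∷ ps) =
    trans (cons m d p ps) (cong (λ s → if does (d ∣? m) then p ∷ s else s) (selectDivisors-unique {F} nil cons m (suc d) ps))

  -- The same for Defs' private divisor filter.  As `with` abstracts the normalised goal,
  -- in which the literal 1 occurs elsewhere too, the index 2 of the filter's second step
  -- is generalised instead.
  mutual
    private
      selectDiv′ : ℕ → ℕ → List Poly → List Poly
      selectDiv′ = _

    Φ-suc : ∀ n → Φ (suc n) ≡ divMonic (xⁿ-1 (suc n)) (productₚ (selectDivisors (suc n) 1 (cyclos n)))
    Φ-suc n with suc n | cyclos n
    ... | m | []     = refl
    ... | m | p ∷ ps with 2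
    ... | d = cong (λ s → divMonic (xⁿ-1 (suc n)) (productₚ (if does (1 ∣? m) then p ∷ s else s)))
                   (selectDivisors-unique {selectDiv′} (λ _ _ → refl) (λ _ _ _ _ → refl) m d ps)

  length-cyclos : ∀ n → length (cyclos n) ≡ n
  length-cyclos zero    = refl
  length-cyclos (suc n) = trans (List.length-++ (cyclos n)) (trans (cong (ℕ._+ 1) (length-cyclos n)) (ℕ.+-comm n 1))

  cyclos-All : ∀ {R : Poly → Set} n → (∀ {j} → 1 ≤ j → j ≤ n → R (Φ j)) → All R (cyclos n)
  cyclos-All zero    RΦ = []
  cyclos-All (suc n) RΦ = All.++⁺ (cyclos-All n (λ 1≤j j≤n → RΦ 1≤j (ℕ.m≤n⇒m≤1+n j≤n))) (RΦ (s≤s z≤n) ℕ.≤-refl ∷ [])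

  selectDivisors-All : ∀ {R : Poly → Set} m d {xs} → All R xs → All R (selectDivisors m d xs)
  selectDivisors-All m d []                = []
  selectDivisors-All m d {x ∷ xs} (r ∷ rs) with does (d ∣? m)
  ... | true  = r ∷ selectDivisors-All m (suc d) rs
  ... | false = selectDivisors-All m (suc d) rs

  appendIfDivides : ℕ → ℕ → Poly → List Poly → List Poly
  appendIfDivides j m p ys = ys ++ (if does (j ∣? m) then [ p ] else [])

  selectDivisors-∷ʳ : ∀ m d xs p →
    selectDivisors m d (xs ++ [ p ]) ≡ appendIfDivides (length xs ℕ.+ d) m p (selectDivisors m d xs)
  selectDivisors-∷ʳ m d []       p with does (d ∣? m)
  ... | true  = refl
  ... | false = refl
  selectDivisors-∷ʳ m d (x ∷ xs) p with does (d ∣? m)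
  ... | true  = cong (x ∷_) (trans (selectDivisors-∷ʳ m (suc d) xs p)
                                   (cong (λ j → appendIfDivides j m p (selectDivisors m (suc d) xs)) (ℕ.+-suc (length xs) d)))
  ... | false = trans (selectDivisors-∷ʳ m (suc d) xs p)
                      (cong (λ j → appendIfDivides j m p (selectDivisors m (suc d) xs)) (ℕ.+-suc (length xs) d))

  Monic-productₚ : ∀ {xs} → All Monic xs → Monic (productₚ xs)
  Monic-productₚ []       = [] , refl
  Monic-productₚ (m ∷ ms) = Monic-*ₚ m (Monic-productₚ ms)

  productₚ-++ : ∀ xs ys → productₚ (xs ++ ys) ≈ₚ productₚ xs *ₚ productₚ ys
  productₚ-++ []       ys = ≈ₚ-sym (*ₚ-identityˡ (productₚ ys))
  productₚ-++ (x ∷ xs) ys = begin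
    x *ₚ productₚ (xs ++ ys)                ≈⟨ *ₚ-congʳ x (productₚ-++ xs ys) ⟩
    x *ₚ (productₚ xs *ₚ productₚ ys)       ≈⟨ ≈ₚ-sym (*ₚ-assoc x (productₚ xs) (productₚ ys)) ⟩
    (x *ₚ productₚ xs) *ₚ productₚ ys       ∎

  productₚ-selectDivisors : ∀ m N → productₚ (selectDivisors m 1 (cyclos N)) ≈ₚ ∏ N (_∣? m) Φ
  productₚ-selectDivisors m zero    = ≈ₚ-refl
  productₚ-selectDivisors m (suc N) = begin
    productₚ (selectDivisors m 1 (cyclos N ++ [ Φ (suc N) ]))
      ≡⟨ cong productₚ (trans (selectDivisors-∷ʳ m 1 (cyclos N) (Φ (suc N)))
                              (cong (λ j → appendIfDivides j m (Φ (suc N)) (selectDivisors m 1 (cyclos N)))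
                                    (trans (cong (ℕ._+ 1) (length-cyclos N)) (ℕ.+-comm N 1)))) ⟩
    productₚ (selectDivisors m 1 (cyclos N) ++ (if does (suc N ∣? m) then [ Φ (suc N) ] else []))
      ≈⟨ productₚ-++ (selectDivisors m 1 (cyclos N)) _ ⟩
    productₚ (selectDivisors m 1 (cyclos N)) *ₚ productₚ (if does (suc N ∣? m) then [ Φ (suc N) ] else [])
      ≈⟨ *ₚ-congˡ _ (productₚ-selectDivisors m N) ⟩
    ∏ N (_∣? m) Φ *ₚ productₚ (if does (suc N ∣? m) then [ Φ (suc N) ] else [])
      ≈⟨ last (suc N ∣? m) ⟩
    ∏ (suc N) (_∣? m) Φ ∎
    where
    last : ∀ d → ∏ N (_∣? m) Φ *ₚ productₚ (if does d then [ Φ (suc N) ] else [])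
                 ≈ₚ (if does d then ∏ N (_∣? m) Φ *ₚ Φ (suc N) else ∏ N (_∣? m) Φ)
    last (yes _) = *ₚ-congʳ (∏ N (_∣? m) Φ) (≈ₚ-trans (*ₚ-comm (Φ (suc N)) 1ₚ) (*ₚ-identityˡ (Φ (suc N))))
    last (no _)  = ≈ₚ-trans (*ₚ-comm (∏ N (_∣? m) Φ) 1ₚ) (*ₚ-identityˡ (∏ N (_∣? m) Φ))

  X^≈ : ∀ n → replicate n (+ 0) ++ [ + 1 ] ≈ₚ X^ n
  X^≈ zero    = ≈ₚ-refl
  X^≈ (suc n) = ≈ₚ-trans (refl ∷ X^≈ n) (≈ₚ-sym (X*ₚ (X^ n)))

  xⁿ-1≈ : ∀ n → xⁿ-1 (suc n) ≈ₚ X^ suc n -ₚ 1ₚ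
  xⁿ-1≈ n = begin
    -[1+ 0 ] ∷ (replicate n (+ 0) ++ [ + 1 ])  ≈⟨ refl ∷ X^≈ n ⟩
    -[1+ 0 ] ∷ X^ n                            ≡⟨ cong (-[1+ 0 ] ∷_) (sym (+ₚ-identityʳ (X^ n))) ⟩
    (+ 0 ∷ X^ n) +ₚ (-[1+ 0 ] ∷ [])            ≈⟨ +ₚ-congˡ (-ₚ 1ₚ) (≈ₚ-sym (X*ₚ (X^ n))) ⟩
    X^ suc n -ₚ 1ₚ                             ∎

  CoprimeOverℚ : Poly → Poly → Set
  CoprimeOverℚ A B = ∃₂ λ U V → ∃ λ c → c ≢ + 0 × U *ₚ A +ₚ V *ₚ B ≈ₚ const c

  CoprimeOverℚ-1ₚ : ∀ B → CoprimeOverℚ 1ₚ B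
  CoprimeOverℚ-1ₚ B = 1ₚ , [] , + 1 , (λ ()) , ≈ₚ-refl

  CoprimeOverℚ-*ₚ : ∀ {A B C} → CoprimeOverℚ A C → CoprimeOverℚ B C → CoprimeOverℚ (A *ₚ B) C
  CoprimeOverℚ-*ₚ {A} {B} {C} (U₁ , V₁ , c₁ , c₁≢0 , eq₁) (U₂ , V₂ , c₂ , c₂≢0 , eq₂) =
    U₁ *ₚ U₂ , U₁ *ₚ A *ₚ V₂ +ₚ V₁ *ₚ U₂ *ₚ B +ₚ V₁ *ₚ V₂ *ₚ C , c₁ ℤ.* c₂ , c₁c₂≢0 , (begin
      (U₁ *ₚ U₂) *ₚ (A *ₚ B) +ₚ (U₁ *ₚ A *ₚ V₂ +ₚ V₁ *ₚ U₂ *ₚ B +ₚ V₁ *ₚ V₂ *ₚ C) *ₚ C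
        ≈⟨ solve 7 (λ U₁ U₂ V₁ V₂ A B C → (U₁ :* U₂) :* (A :* B) :+ (U₁ :* A :* V₂ :+ V₁ :* U₂ :* B :+ V₁ :* V₂ :* C) :* C
                                          := (U₁ :* A :+ V₁ :* C) :* (U₂ :* B :+ V₂ :* C)) ≈ₚ-refl U₁ U₂ V₁ V₂ A B C ⟩
      (U₁ *ₚ A +ₚ V₁ *ₚ C) *ₚ (U₂ *ₚ B +ₚ V₂ *ₚ C) ≈⟨ *ₚ-cong eq₁ eq₂ ⟩
      const c₁ *ₚ const c₂                          ≈⟨ ℤ.+-identityʳ (c₁ ℤ.* c₂) ∷ [] ⟩
      const (c₁ ℤ.* c₂)                             ∎)
    where
    c₁c₂≢0 : c₁ ℤ.* c₂ ≢ + 0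
    c₁c₂≢0 c₁c₂≡0 with ℤ.i*j≡0⇒i≡0∨j≡0 c₁ c₁c₂≡0
    ... | inj₁ c₁≡0 = c₁≢0 c₁≡0
    ... | inj₂ c₂≡0 = c₂≢0 c₂≡0

  ∣ₚ-lcm : ∀ {A B C} → Monic A → Monic B → CoprimeOverℚ A B → A ∣ₚ C → B ∣ₚ C → A *ₚ B ∣ₚ C
  ∣ₚ-lcm {A} {B} {C} monicA monicB (U , V , c , c≢0 , UA+VB≈c) (K_A , K_A*A≈C) (K_B , K_B*B≈C) =
    monic-∣-scaled (Monic-*ₚ monicA monicB) c≢0 (U *ₚ K_B +ₚ V *ₚ K_A , (begin
      (U *ₚ K_B +ₚ V *ₚ K_A) *ₚ (A *ₚ B)
        ≈⟨ solve 6 (λ U V A B K_A K_B → (U :* K_B :+ V :* K_A) :* (A :* B) := (U :* A) :* (K_B :* B) :+ (V :* B) :* (K_A :* A))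
             ≈ₚ-refl U V A B K_A K_B ⟩
      (U *ₚ A) *ₚ (K_B *ₚ B) +ₚ (V *ₚ B) *ₚ (K_A *ₚ A) ≈⟨ +ₚ-cong (*ₚ-congʳ (U *ₚ A) K_B*B≈C) (*ₚ-congʳ (V *ₚ B) K_A*A≈C) ⟩
      (U *ₚ A) *ₚ C +ₚ (V *ₚ B) *ₚ C                   ≈⟨ ≈ₚ-sym (*ₚ-distribʳ (U *ₚ A) (V *ₚ B) C) ⟩
      (U *ₚ A +ₚ V *ₚ B) *ₚ C                          ≈⟨ *ₚ-congˡ C UA+VB≈c ⟩
      const c *ₚ C                                     ∎))

  CyclotomicFactorisation : ℕ → Set
  CyclotomicFactorisation n = Monic (Φ n) × ∏ n (_∣? n) Φ ≈ₚ X^ n -ₚ 1ₚ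

  cofactor : ℕ → Poly
  cofactor n = ∏ (n ∸ 1) (_∣? n) Φ

  ∏Φ-divisors : ∀ k → ∏ (suc k) (_∣? suc k) Φ ≡ cofactor (suc k) *ₚ Φ (suc k)
  ∏Φ-divisors k = ∏-suc-yes k (_∣? suc k) Φ ℕ.∣-refl

  module Step (k : ℕ) (IH : ∀ {j} → 1 ≤ j → j ≤ k → CyclotomicFactorisation j) where

    Φ-monic′ : ∀ {j} → 1 ≤ j → j ≤ k → Monic (Φ j)
    Φ-monic′ 1≤j j≤k = proj₁ (IH 1≤j j≤k)

    ∏Φ-monic : ∀ {P} N (P? : Decidable P) → N ≤ k → Monic (∏ N P? Φ)
    ∏Φ-monic N P? N≤k = ∏-closed Monic N P? Φ ([] , refl) Monic-*ₚ (λ 1≤j j≤N _ → Φ-monic′ 1≤j (ℕ.≤-trans j≤N N≤k))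

    cofactor-*-Φ : ∀ {j} → 1 ≤ j → j ≤ k → cofactor j *ₚ Φ j ≈ₚ X^ j -ₚ 1ₚ
    cofactor-*-Φ {suc i} 1≤j j≤k = subst (_≈ₚ X^ suc i -ₚ 1ₚ) (∏Φ-divisors i) (proj₂ (IH 1≤j j≤k))

    ∏Φ-∣-cofactor : ∀ {g j} → 1 ≤ g → g < j → g ℕ.∣ j → ∏ g (_∣? g) Φ ∣ₚ cofactor j
    ∏Φ-∣-cofactor {g} {suc i} 1≤g (s≤s g≤i) g∣j =
      subst (_∣ₚ cofactor (suc i)) (∏-range (_∣? g) Φ g≤i (λ g<l _ l∣g → ℕ.<⇒≱ g<l (ℕ.∣⇒≤ ⦃ ℕ.>-nonZero 1≤g ⦄ l∣g)))
            (∏-⊆-∣ i (_∣? g) (_∣? suc i) Φ (λ _ _ l∣g → ℕ.∣-trans l∣g g∣j))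

    Φ-∣-geom : ∀ {g e t} → 1 ≤ g → g < e → e ≤ k → e ≡ t * g → ∃ λ H → Φ e *ₚ H ≈ₚ geom g t
    Φ-∣-geom {g} {e} {t} 1≤g g<e e≤k e≡tg = H , *ₚ-cancelʳ-monic (∏Φ-monic g (_∣? g) g≤k) (begin
      (Φ e *ₚ H) *ₚ M           ≈⟨ *ₚ-assoc (Φ e) H M ⟩
      Φ e *ₚ (H *ₚ M)           ≈⟨ *ₚ-congʳ (Φ e) (equality M∣cofactor) ⟩
      Φ e *ₚ cofactor e         ≈⟨ *ₚ-comm (Φ e) (cofactor e) ⟩
      cofactor e *ₚ Φ e         ≈⟨ cofactor-*-Φ (ℕ.≤-trans 1≤g (ℕ.<⇒≤ g<e)) e≤k ⟩
      X^ e -ₚ 1ₚ                ≡⟨ cong (λ n → X^ n -ₚ 1ₚ) (trans e≡tg (ℕ.*-comm t g)) ⟩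
      X^ (g * t) -ₚ 1ₚ          ≈⟨ ≈ₚ-sym (geom-* g t) ⟩
      geom g t *ₚ (X^ g -ₚ 1ₚ)  ≈⟨ *ₚ-congʳ (geom g t) (≈ₚ-sym (proj₂ (IH 1≤g g≤k))) ⟩
      geom g t *ₚ M             ∎)
      where
      g≤k : g ≤ k
      g≤k = ℕ.≤-trans (ℕ.<⇒≤ g<e) e≤k
      M : Poly
      M = ∏ g (_∣? g) Φ
      M∣cofactor : M ∣ₚ cofactor e
      M∣cofactor = ∏Φ-∣-cofactor 1≤g g<e (divides t e≡tg)
      H : Poly
      H = quotient M∣cofactor

    -- With g = gcd d e < e: Φ e divides (X^e - 1)/(X^g - 1) ≡ e/g (mod X^g - 1),
    -- and X^g - 1 lies in the ideal (X^d - 1, X^e - 1) ⊆ (Φ d, Φ e).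
    Φ-coprime : ∀ {d e} → 1 ≤ d → d ≤ k → 1 ≤ e → e ≤ k → ¬ e ℕ.∣ d → CoprimeOverℚ (Φ d) (Φ e)
    Φ-coprime {d} {e} 1≤d d≤k 1≤e e≤k e∤d with gcd[m,n]∣n d e
    ... | divides t e≡tg with Φ-∣-geom {t = t} 1≤g g<e e≤k e≡tg
      where
      g : ℕ
      g = gcd d e
      1≤g : 1 ≤ g
      1≤g = ℕ.n≢0⇒n>0 (gcd[m,n]≢0 d e (inj₂ (λ e≡0 → ℕ.<⇒≢ 1≤e (sym e≡0))))
      g<e : g < e
      g<e = ℕ.≤∧≢⇒< (ℕ.∣⇒≤ ⦃ ℕ.>-nonZero 1≤e ⦄ (gcd[m,n]∣n d e)) (λ g≡e → e∤d (subst (ℕ._∣ d) g≡e (gcd[m,n]∣m d e)))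
    ... | H , Φe*H≈geom =
      -ₚ (W *ₚ U *ₚ cofactor d) , H -ₚ W *ₚ V *ₚ cofactor e , + t , t≢0 , (begin
        -ₚ (W *ₚ U *ₚ cofactor d) *ₚ Φ d +ₚ (H -ₚ W *ₚ V *ₚ cofactor e) *ₚ Φ e
          ≈⟨ solve 8 (λ W U V H Cd Ce Fd Fe → (:- (W :* U :* Cd)) :* Fd :+ (H :- W :* V :* Ce) :* Fe
                                               := Fe :* H :- W :* (U :* (Cd :* Fd) :+ V :* (Ce :* Fe)))
               ≈ₚ-refl W U V H (cofactor d) (cofactor e) (Φ d) (Φ e) ⟩
        Φ e *ₚ H -ₚ W *ₚ (U *ₚ (cofactor d *ₚ Φ d) +ₚ V *ₚ (cofactor e *ₚ Φ e))
          ≈⟨ +ₚ-cong Φe*H≈geom (-ₚ-cong (*ₚ-congʳ W (+ₚ-cong (*ₚ-congʳ U (cofactor-*-Φ 1≤d d≤k))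
                                                               (*ₚ-congʳ V (cofactor-*-Φ 1≤e e≤k))))) ⟩
        geom g t -ₚ W *ₚ (U *ₚ (X^ d -ₚ 1ₚ) +ₚ V *ₚ (X^ e -ₚ 1ₚ))
          ≈⟨ +ₚ-cong (proj₂ (geom-mod g t)) (-ₚ-cong (*ₚ-congʳ W (proj₂ (proj₂ (X^-1-bezout d e))))) ⟩
        W *ₚ (X^ g -ₚ 1ₚ) +ₚ const (+ t) -ₚ W *ₚ (X^ g -ₚ 1ₚ)
          ≈⟨ solve 2 (λ A C → A :+ C :- A := C) ≈ₚ-refl (W *ₚ (X^ g -ₚ 1ₚ)) (const (+ t)) ⟩
        const (+ t) ∎)
      where
      g : ℕ
      g = gcd d e
      W : Poly
      W = proj₁ (geom-mod g t)
      U : Poly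
      U = proj₁ (X^-1-bezout d e)
      V : Poly
      V = proj₁ (proj₂ (X^-1-bezout d e))
      t≢0 : + t ≢ + 0
      t≢0 refl = ℕ.<⇒≢ 1≤e (sym e≡tg)

    private
      n : ℕ
      n = suc k

    ∏Φ-∣-X^n-1 : ∀ N → N ≤ k → ∏ N (_∣? n) Φ ∣ₚ X^ n -ₚ 1ₚ
    ∏Φ-∣-X^n-1 zero    _   = X^ n -ₚ 1ₚ , ≈ₚ-trans (*ₚ-comm (X^ n -ₚ 1ₚ) 1ₚ) (*ₚ-identityˡ (X^ n -ₚ 1ₚ))
    ∏Φ-∣-X^n-1 (suc N) N<k with suc N ∣? n
    ... | no  sN∤n = subst (_∣ₚ X^ n -ₚ 1ₚ) (sym (∏-suc-no N (_∣? n) Φ sN∤n)) (∏Φ-∣-X^n-1 N (ℕ.<⇒≤ N<k))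
    ... | yes sN∣n = subst (_∣ₚ X^ n -ₚ 1ₚ) (sym (∏-suc-yes N (_∣? n) Φ sN∣n))
                       (∣ₚ-lcm (∏Φ-monic N (_∣? n) (ℕ.<⇒≤ N<k)) (Φ-monic′ (s≤s z≤n) N<k) coprime
                               (∏Φ-∣-X^n-1 N (ℕ.<⇒≤ N<k)) Φ∣X^n-1)
      where
      coprime : CoprimeOverℚ (∏ N (_∣? n) Φ) (Φ (suc N))
      coprime = ∏-closed (λ A → CoprimeOverℚ A (Φ (suc N))) N (_∣? n) Φ (CoprimeOverℚ-1ₚ (Φ (suc N))) CoprimeOverℚ-*ₚ
                  (λ 1≤d d≤N _ → Φ-coprime 1≤d (ℕ.≤-trans d≤N (ℕ.<⇒≤ N<k)) (s≤s z≤n) N<k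
                                   (λ sN∣d → ℕ.<⇒≱ (s≤s d≤N) (ℕ.∣⇒≤ ⦃ ℕ.>-nonZero 1≤d ⦄ sN∣d)))
      Φ∣X^n-1 : Φ (suc N) ∣ₚ X^ n -ₚ 1ₚ
      Φ∣X^n-1 with X^-1-∣ sN∣n
      ... | Q , Q*X^sN-1≈X^n-1 = Q *ₚ cofactor (suc N) , (begin
        (Q *ₚ cofactor (suc N)) *ₚ Φ (suc N)  ≈⟨ *ₚ-assoc Q (cofactor (suc N)) (Φ (suc N)) ⟩
        Q *ₚ (cofactor (suc N) *ₚ Φ (suc N))  ≈⟨ *ₚ-congʳ Q (cofactor-*-Φ (s≤s z≤n) N<k) ⟩
        Q *ₚ (X^ suc N -ₚ 1ₚ)                 ≈⟨ Q*X^sN-1≈X^n-1 ⟩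
        X^ n -ₚ 1ₚ                            ∎)

    factorisation : CyclotomicFactorisation n
    factorisation with ∏Φ-∣-X^n-1 k ℕ.≤-refl
                     | Monic-productₚ (selectDivisors-All n 1 (cyclos-All k Φ-monic′))
    ... | K , K*cofactor≈X^n-1 | m , selected≡m∷ʳ1 = Φn-monic , ∏Φ≈X^n-1
      where
      xⁿ-1≈K*selected : xⁿ-1 n ≈ₚ K *ₚ (m ++ [ + 1 ])
      xⁿ-1≈K*selected = begin
        xⁿ-1 n                                          ≈⟨ xⁿ-1≈ k ⟩
        X^ n -ₚ 1ₚ                                      ≈⟨ ≈ₚ-sym K*cofactor≈X^n-1 ⟩
        K *ₚ cofactor n                                 ≈⟨ *ₚ-congʳ K (≈ₚ-sym (productₚ-selectDivisors n k)) ⟩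
        K *ₚ productₚ (selectDivisors n 1 (cyclos k))   ≡⟨ cong (K *ₚ_) selected≡m∷ʳ1 ⟩
        K *ₚ (m ++ [ + 1 ])                             ∎
      Φ≡ : Φ n ≡ divMonic (xⁿ-1 n) (m ++ [ + 1 ])
      Φ≡ = trans (Φ-suc k) (cong (divMonic (xⁿ-1 n)) selected≡m∷ʳ1)
      Φ≈K : Φ n ≈ₚ K
      Φ≈K = subst (_≈ₚ K) (sym Φ≡) (divMonic-exact (xⁿ-1 n) m K xⁿ-1≈K*selected)
      Φn-monic : Monic (Φ n)
      Φn-monic = subst Monic (sym Φ≡)
                  (divMonic-monic (-[1+ 0 ] ∷ replicate k (+ 0)) m (∣ₚ-length {K = K} m (λ ()) xⁿ-1≈K*selected))
      ∏Φ≈X^n-1 : ∏ n (_∣? n) Φ ≈ₚ X^ n -ₚ 1ₚ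
      ∏Φ≈X^n-1 = begin
        ∏ n (_∣? n) Φ          ≡⟨ ∏Φ-divisors k ⟩
        cofactor n *ₚ Φ n      ≈⟨ *ₚ-congʳ (cofactor n) Φ≈K ⟩
        cofactor n *ₚ K        ≈⟨ *ₚ-comm (cofactor n) K ⟩
        K *ₚ cofactor n        ≈⟨ K*cofactor≈X^n-1 ⟩
        X^ n -ₚ 1ₚ             ∎

  cyclotomicFactorisation : ∀ n → 1 ≤ n → CyclotomicFactorisation n
  cyclotomicFactorisation = <-rec (λ n → 1 ≤ n → CyclotomicFactorisation n) step
    where
    step : ∀ n → (∀ {j} → j < n → 1 ≤ j → CyclotomicFactorisation j) → 1 ≤ n → CyclotomicFactorisation n
    step (suc k) rec _ = Step.factorisation k (λ 1≤j j≤k → rec (s≤s j≤k) 1≤j)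

  Φ-monic : ∀ n → Monic (Φ n)
  Φ-monic zero    = [] , refl
  Φ-monic (suc n) = proj₁ (cyclotomicFactorisation (suc n) (s≤s z≤n))

  ∏Φ-divisors≈X^n-1 : ∀ n → 1 ≤ n → ∏ n (_∣? n) Φ ≈ₚ X^ n -ₚ 1ₚ
  ∏Φ-divisors≈X^n-1 n 1≤n = proj₂ (cyclotomicFactorisation n 1≤n)


-- Gaussian integers

open ℤ[i] using (re; im)

infixl 6 _+ᵢ_
infixl 7 _*ᵢ_

_+ᵢ_ : ℤ[i] → ℤ[i] → ℤ[i]
(a +i b) +ᵢ (c +i d) = (a ℤ.+ c) +i (b ℤ.+ d)

_*ᵢ_ : ℤ[i] → ℤ[i] → ℤ[i]
(a +i b) *ᵢ (c +i d) = (a ℤ.* c ℤ.- b ℤ.* d) +i (a ℤ.* d ℤ.+ b ℤ.* c)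

-ᵢ_ : ℤ[i] → ℤ[i]
-ᵢ (a +i b) = ℤ.- a +i ℤ.- b

ι : ℤ → ℤ[i]
ι a = a +i + 0

0ᵢ 1ᵢ 𝕚 : ℤ[i]
0ᵢ = ι (+ 0)
1ᵢ = ι (+ 1)
𝕚  = + 0 +i + 1

*ᵢ-comm : ∀ z w → z *ᵢ w ≡ w *ᵢ z
*ᵢ-comm (a +i b) (c +i d) = cong₂ _+i_
  (solve 4 (λ a b c d → a :* c :- b :* d := c :* a :- d :* b) refl a b c d)
  (solve 4 (λ a b c d → a :* d :+ b :* c := c :* b :+ d :* a) refl a b c d)
  where open ℤ-Solver using (solve; _:+_; _:*_; _:-_; _:=_)

*ᵢ-assoc : ∀ x y z → (x *ᵢ y) *ᵢ z ≡ x *ᵢ (y *ᵢ z)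
*ᵢ-assoc (a +i b) (c +i d) (e +i f) = cong₂ _+i_
  (solve 6 (λ a b c d e f → (a :* c :- b :* d) :* e :- (a :* d :+ b :* c) :* f
                             := a :* (c :* e :- d :* f) :- b :* (c :* f :+ d :* e)) refl a b c d e f)
  (solve 6 (λ a b c d e f → (a :* c :- b :* d) :* f :+ (a :* d :+ b :* c) :* e
                             := a :* (c :* f :+ d :* e) :+ b :* (c :* e :- d :* f)) refl a b c d e f)
  where open ℤ-Solver using (solve; _:+_; _:*_; _:-_; _:=_)

*ᵢ-identityˡ : ∀ z → 1ᵢ *ᵢ z ≡ z
*ᵢ-identityˡ (a +i b) = cong₂ _+i_
  (solve 2 (λ a b → con (+ 1) :* a :- con (+ 0) :* b := a) refl a b)
  (solve 2 (λ a b → con (+ 1) :* b :+ con (+ 0) :* a := b) refl a b)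
  where open ℤ-Solver using (solve; _:+_; _:*_; _:-_; _:=_; con)

*ᵢ-identityʳ : ∀ z → z *ᵢ 1ᵢ ≡ z
*ᵢ-identityʳ z = trans (*ᵢ-comm z 1ᵢ) (*ᵢ-identityˡ z)

*ᵢ-distribʳ : ∀ x y z → (y +ᵢ z) *ᵢ x ≡ y *ᵢ x +ᵢ z *ᵢ x
*ᵢ-distribʳ (a +i b) (c +i d) (e +i f) = cong₂ _+i_
  (solve 6 (λ a b c d e f → (c :+ e) :* a :- (d :+ f) :* b := (c :* a :- d :* b) :+ (e :* a :- f :* b)) refl a b c d e f)
  (solve 6 (λ a b c d e f → (c :+ e) :* b :+ (d :+ f) :* a := (c :* b :+ d :* a) :+ (e :* b :+ f :* a)) refl a b c d e f)
  where open ℤ-Solver using (solve; _:+_; _:*_; _:-_; _:=_)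

ℤ[i]-isCommutativeRing : IsCommutativeRing _≡_ _+ᵢ_ _*ᵢ_ -ᵢ_ 0ᵢ 1ᵢ
ℤ[i]-isCommutativeRing = record
  { isRing = record
    { +-isAbelianGroup = record
      { isGroup = record
        { isMonoid = record
          { isSemigroup = record
            { isMagma = record { isEquivalence = isEquivalence ; ∙-cong = cong₂ _+ᵢ_ }
            ; assoc = λ { (a +i b) (c +i d) (e +i f) → cong₂ _+i_ (ℤ.+-assoc a c e) (ℤ.+-assoc b d f) } }
          ; identity = (λ { (a +i b) → cong₂ _+i_ (ℤ.+-identityˡ a) (ℤ.+-identityˡ b) })
                     , (λ { (a +i b) → cong₂ _+i_ (ℤ.+-identityʳ a) (ℤ.+-identityʳ b) }) }
        ; inverse = (λ { (a +i b) → cong₂ _+i_ (ℤ.+-inverseˡ a) (ℤ.+-inverseˡ b) })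
                  , (λ { (a +i b) → cong₂ _+i_ (ℤ.+-inverseʳ a) (ℤ.+-inverseʳ b) })
        ; ⁻¹-cong = cong -ᵢ_ }
      ; comm = λ { (a +i b) (c +i d) → cong₂ _+i_ (ℤ.+-comm a c) (ℤ.+-comm b d) } }
    ; *-cong = cong₂ _*ᵢ_
    ; *-assoc = *ᵢ-assoc
    ; *-identity = *ᵢ-identityˡ , *ᵢ-identityʳ
    ; distrib = (λ x y z → trans (*ᵢ-comm x (y +ᵢ z)) (trans (*ᵢ-distribʳ x y z) (cong₂ _+ᵢ_ (*ᵢ-comm y x) (*ᵢ-comm z x))))
              , *ᵢ-distribʳ }
  ; *-comm = *ᵢ-comm }

ℤ[i]-commutativeRing : CommutativeRing _ _
ℤ[i]-commutativeRing = record { isCommutativeRing = ℤ[i]-isCommutativeRing }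

ι-homomorphism : ℤ.+-*-rawRing -Raw-AlmostCommutative⟶ fromCommutativeRing ℤ[i]-commutativeRing
ι-homomorphism = record
  { ⟦_⟧    = ι
  ; +-homo = λ a b → cong₂ _+i_ refl (sym (ℤ.+-identityʳ (+ 0)))
  ; *-homo = λ a b → cong₂ _+i_ (ℤ-Solver.solve 2 (λ a b → a :* b := a :* b :- con (+ 0) :* con (+ 0)) refl a b)
                        (ℤ-Solver.solve 2 (λ a b → con (+ 0) := a :* con (+ 0) :+ con (+ 0) :* b) refl a b)
  ; -‿homo = λ a → refl
  ; 0-homo = refl
  ; 1-homo = refl }
  where open ℤ-Solver using (_:+_; _:*_; _:-_; _:=_; con)

ι-≟ : ∀ a b → Maybe (ι a ≡ ι b)
ι-≟ a b with a ℤ.≟ b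
... | yes refl = just refl
... | no _     = nothing

module ℤ[i]-Solver = Algebra.Solver.Ring ℤ.+-*-rawRing (fromCommutativeRing ℤ[i]-commutativeRing) ι-homomorphism ι-≟

evalAtI-∷ : ∀ a p → evalAtI (a ∷ p) ≡ ι a +ᵢ 𝕚 *ᵢ evalAtI p
evalAtI-∷ a p = cong₂ _+i_ (ℤ-Solver.solve 3 (λ a x y → a :- y := a :+ (con (+ 0) :* x :- con (+ 1) :* y)) refl a x y)
                   (ℤ-Solver.solve 3 (λ a x y → x := con (+ 0) :+ (con (+ 0) :* y :+ con (+ 1) :* x)) refl a x y)
  where
  x : ℤ
  x = re (evalAtI p)
  y : ℤ
  y = im (evalAtI p)
  open ℤ-Solver using (_:+_; _:*_; _:-_; _:=_; con)

evalAtI-+ₚ : ∀ p q → evalAtI (p +ₚ q) ≡ evalAtI p +ᵢ evalAtI q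
evalAtI-+ₚ []      q       = sym (CommutativeRing.+-identityˡ ℤ[i]-commutativeRing (evalAtI q))
evalAtI-+ₚ (a ∷ p) []      = sym (CommutativeRing.+-identityʳ ℤ[i]-commutativeRing (evalAtI (a ∷ p)))
evalAtI-+ₚ (a ∷ p) (b ∷ q) = begin
  evalAtI (a ℤ.+ b ∷ p +ₚ q)                          ≡⟨ evalAtI-∷ (a ℤ.+ b) (p +ₚ q) ⟩
  ι (a ℤ.+ b) +ᵢ 𝕚 *ᵢ evalAtI (p +ₚ q)                ≡⟨ cong (λ z → ι (a ℤ.+ b) +ᵢ 𝕚 *ᵢ z) (evalAtI-+ₚ p q) ⟩
  ι (a ℤ.+ b) +ᵢ 𝕚 *ᵢ (evalAtI p +ᵢ evalAtI q)
    ≡⟨ solve 5 (λ A B I P Q → (A :+ B) :+ I :* (P :+ Q) := (A :+ I :* P) :+ (B :+ I :* Q)) refl (ι a) (ι b) 𝕚 (evalAtI p) (evalAtI q) ⟩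
  (ι a +ᵢ 𝕚 *ᵢ evalAtI p) +ᵢ (ι b +ᵢ 𝕚 *ᵢ evalAtI q)  ≡⟨ sym (cong₂ _+ᵢ_ (evalAtI-∷ a p) (evalAtI-∷ b q)) ⟩
  evalAtI (a ∷ p) +ᵢ evalAtI (b ∷ q)                  ∎
  where
  open ≡-Reasoning
  open ℤ[i]-Solver using (solve; _:+_; _:*_; _:=_)

evalAtI-·ₚ : ∀ a q → evalAtI (a ·ₚ q) ≡ ι a *ᵢ evalAtI q
evalAtI-·ₚ a []      = solve 1 (λ A → con (+ 0) := A :* con (+ 0)) refl (ι a)
  where open ℤ[i]-Solver using (solve; _:*_; _:=_; con)
evalAtI-·ₚ a (x ∷ q) = begin
  evalAtI (a ℤ.* x ∷ a ·ₚ q)                   ≡⟨ evalAtI-∷ (a ℤ.* x) (a ·ₚ q) ⟩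
  ι (a ℤ.* x) +ᵢ 𝕚 *ᵢ evalAtI (a ·ₚ q)          ≡⟨ cong₂ (λ u v → u +ᵢ 𝕚 *ᵢ v) ι-* (evalAtI-·ₚ a q) ⟩
  ι a *ᵢ ι x +ᵢ 𝕚 *ᵢ (ι a *ᵢ evalAtI q)
    ≡⟨ solve 4 (λ A X I Q → A :* X :+ I :* (A :* Q) := A :* (X :+ I :* Q)) refl (ι a) (ι x) 𝕚 (evalAtI q) ⟩
  ι a *ᵢ (ι x +ᵢ 𝕚 *ᵢ evalAtI q)               ≡⟨ cong (ι a *ᵢ_) (sym (evalAtI-∷ x q)) ⟩
  ι a *ᵢ evalAtI (x ∷ q)                        ∎
  where
  open ≡-Reasoning
  open ℤ[i]-Solver using (solve; _:+_; _:*_; _:=_)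
  ι-* : ι (a ℤ.* x) ≡ ι a *ᵢ ι x
  ι-* = _-Raw-AlmostCommutative⟶_.*-homo ι-homomorphism a x

evalAtI-*ₚ : ∀ p q → evalAtI (p *ₚ q) ≡ evalAtI p *ᵢ evalAtI q
evalAtI-*ₚ []      q = solve 1 (λ Q → con (+ 0) := con (+ 0) :* Q) refl (evalAtI q)
  where open ℤ[i]-Solver using (solve; _:*_; _:=_; con)
evalAtI-*ₚ (a ∷ p) q = begin
  evalAtI (a ·ₚ q +ₚ (+ 0 ∷ p *ₚ q))                 ≡⟨ evalAtI-+ₚ (a ·ₚ q) (+ 0 ∷ p *ₚ q) ⟩
  evalAtI (a ·ₚ q) +ᵢ evalAtI (+ 0 ∷ p *ₚ q)         ≡⟨ cong₂ _+ᵢ_ (evalAtI-·ₚ a q) (evalAtI-∷ (+ 0) (p *ₚ q)) ⟩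
  ι a *ᵢ evalAtI q +ᵢ (0ᵢ +ᵢ 𝕚 *ᵢ evalAtI (p *ₚ q))  ≡⟨ cong (λ z → ι a *ᵢ evalAtI q +ᵢ (0ᵢ +ᵢ 𝕚 *ᵢ z)) (evalAtI-*ₚ p q) ⟩
  ι a *ᵢ evalAtI q +ᵢ (0ᵢ +ᵢ 𝕚 *ᵢ (evalAtI p *ᵢ evalAtI q))
    ≡⟨ solve 4 (λ A Q I P → A :* Q :+ (con (+ 0) :+ I :* (P :* Q)) := (A :+ I :* P) :* Q) refl (ι a) (evalAtI q) 𝕚 (evalAtI p) ⟩
  (ι a +ᵢ 𝕚 *ᵢ evalAtI p) *ᵢ evalAtI q              ≡⟨ cong (_*ᵢ evalAtI q) (sym (evalAtI-∷ a p)) ⟩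
  evalAtI (a ∷ p) *ᵢ evalAtI q                      ∎
  where
  open ≡-Reasoning
  open ℤ[i]-Solver using (solve; _:+_; _:*_; _:=_; con)

evalAtI-vanishing : ∀ {p} → [] ≈ₚ p → evalAtI p ≡ 0ᵢ
evalAtI-vanishing []             = refl
evalAtI-vanishing ([]≈0∷ {q} eq) = begin
  evalAtI (+ 0 ∷ q)        ≡⟨ evalAtI-∷ (+ 0) q ⟩
  0ᵢ +ᵢ 𝕚 *ᵢ evalAtI q     ≡⟨ cong (λ z → 0ᵢ +ᵢ 𝕚 *ᵢ z) (evalAtI-vanishing eq) ⟩
  0ᵢ +ᵢ 𝕚 *ᵢ 0ᵢ           ≡⟨⟩
  0ᵢ                      ∎
  where open ≡-Reasoning

evalAtI-cong : ∀ {p q} → p ≈ₚ q → evalAtI p ≡ evalAtI q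
evalAtI-cong []           = refl
evalAtI-cong ([]≈0∷ eq)   = sym (evalAtI-vanishing ([]≈0∷ eq))
evalAtI-cong (0∷≈[] eq)   = evalAtI-vanishing ([]≈0∷ (≈ₚ-sym eq))
evalAtI-cong {a ∷ p} {_ ∷ q} (refl ∷ eq) =
  trans (evalAtI-∷ a p) (trans (cong (λ z → ι a +ᵢ 𝕚 *ᵢ z) (evalAtI-cong eq)) (sym (evalAtI-∷ a q)))

infixr 8 _^ᵢ_
_^ᵢ_ : ℤ[i] → ℕ → ℤ[i]
z ^ᵢ zero  = 1ᵢ
z ^ᵢ suc n = z *ᵢ z ^ᵢ n

evalAtI-X^ : ∀ n → evalAtI (X^ n) ≡ 𝕚 ^ᵢ n
evalAtI-X^ zero    = refl
evalAtI-X^ (suc n) = trans (evalAtI-*ₚ X (X^ n)) (cong (𝕚 *ᵢ_) (evalAtI-X^ n))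

evalAtI-X^-1 : ∀ n → evalAtI (X^ n -ₚ 1ₚ) ≡ 𝕚 ^ᵢ n +ᵢ -ᵢ 1ᵢ
evalAtI-X^-1 n = trans (evalAtI-+ₚ (X^ n) (-ₚ 1ₚ)) (cong (_+ᵢ -ᵢ 1ᵢ) (evalAtI-X^ n))

evalAtI-geom4 : ∀ t → evalAtI (geom 4 t) ≡ ι (+ t)
evalAtI-geom4 zero    = refl
evalAtI-geom4 (suc t) = begin
  evalAtI (1ₚ +ₚ X^ 4 *ₚ geom 4 t)              ≡⟨ evalAtI-+ₚ 1ₚ (X^ 4 *ₚ geom 4 t) ⟩
  1ᵢ +ᵢ evalAtI (X^ 4 *ₚ geom 4 t)              ≡⟨ cong (1ᵢ +ᵢ_) (evalAtI-*ₚ (X^ 4) (geom 4 t)) ⟩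
  1ᵢ +ᵢ evalAtI (X^ 4) *ᵢ evalAtI (geom 4 t)    ≡⟨ cong₂ (λ u v → 1ᵢ +ᵢ u *ᵢ v) (evalAtI-X^ 4) (evalAtI-geom4 t) ⟩
  1ᵢ +ᵢ 1ᵢ *ᵢ ι (+ t)                           ≡⟨ cong (1ᵢ +ᵢ_) (*ᵢ-identityˡ (ι (+ t))) ⟩
  ι (+ suc t)                                   ∎
  where open ≡-Reasoning

𝕚*ᵢ : ∀ a b → 𝕚 *ᵢ (a +i b) ≡ ℤ.- b +i a
𝕚*ᵢ a b = cong₂ _+i_ (ℤ-Solver.solve 2 (λ a b → con (+ 0) :* a :- con (+ 1) :* b := :- b) refl a b)
             (ℤ-Solver.solve 2 (λ a b → con (+ 0) :* b :+ con (+ 1) :* a := a) refl a b)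
  where open ℤ-Solver using (_:+_; _:*_; _:-_; :-_; _:=_; con)

𝕚⁴*ᵢ : ∀ z → 𝕚 *ᵢ (𝕚 *ᵢ (𝕚 *ᵢ (𝕚 *ᵢ z))) ≡ z
𝕚⁴*ᵢ (a +i b) = begin
  𝕚 *ᵢ (𝕚 *ᵢ (𝕚 *ᵢ (𝕚 *ᵢ (a +i b))))       ≡⟨ cong (λ z → 𝕚 *ᵢ (𝕚 *ᵢ (𝕚 *ᵢ z))) (𝕚*ᵢ a b) ⟩
  𝕚 *ᵢ (𝕚 *ᵢ (𝕚 *ᵢ (ℤ.- b +i a)))           ≡⟨ cong (λ z → 𝕚 *ᵢ (𝕚 *ᵢ z)) (𝕚*ᵢ (ℤ.- b) a) ⟩
  𝕚 *ᵢ (𝕚 *ᵢ (ℤ.- a +i ℤ.- b))              ≡⟨ cong (𝕚 *ᵢ_) (𝕚*ᵢ (ℤ.- a) (ℤ.- b)) ⟩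
  𝕚 *ᵢ (ℤ.- (ℤ.- b) +i ℤ.- a)               ≡⟨ 𝕚*ᵢ (ℤ.- (ℤ.- b)) (ℤ.- a) ⟩
  ℤ.- (ℤ.- a) +i ℤ.- (ℤ.- b)                ≡⟨ cong₂ _+i_ (ℤ.neg-involutive a) (ℤ.neg-involutive b) ⟩
  a +i b                                    ∎
  where open ≡-Reasoning

𝕚^-periodic : ∀ r q → 𝕚 ^ᵢ (r ℕ.+ 4 ℕ.* q) ≡ 𝕚 ^ᵢ r
𝕚^-periodic (suc r) q = cong (𝕚 *ᵢ_) (𝕚^-periodic r q)
𝕚^-periodic zero zero    = refl
𝕚^-periodic zero (suc q) = trans (cong (𝕚 ^ᵢ_) (ℕ.*-suc 4 q)) (trans (𝕚⁴*ᵢ (𝕚 ^ᵢ (4 ℕ.* q))) (𝕚^-periodic zero q))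

ι-*ᵢ-cancel : ∀ c {z w} → c ≢ + 0 → ι c *ᵢ z ≡ ι c *ᵢ w → z ≡ w
ι-*ᵢ-cancel c {a +i b} {a′ +i b′} c≢0 eq = cong₂ _+i_
  (ℤ.*-cancelˡ-≡ c a a′ ⦃ ℤ.≢-nonZero c≢0 ⦄ (trans (sym (re-eq a b)) (trans (cong re eq) (re-eq a′ b′))))
  (ℤ.*-cancelˡ-≡ c b b′ ⦃ ℤ.≢-nonZero c≢0 ⦄ (trans (sym (im-eq a b)) (trans (cong im eq) (im-eq a′ b′))))
  where
  open ℤ-Solver using (_:+_; _:*_; _:-_; _:=_; con)
  re-eq : ∀ a b → c ℤ.* a ℤ.- + 0 ℤ.* b ≡ c ℤ.* a
  re-eq a b = ℤ-Solver.solve 3 (λ c a b → c :* a :- con (+ 0) :* b := c :* a) refl c a b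
  im-eq : ∀ a b → c ℤ.* b ℤ.+ + 0 ℤ.* a ≡ c ℤ.* b
  im-eq a b = ℤ-Solver.solve 3 (λ c a b → c :* b :+ con (+ 0) :* a := c :* b) refl c a b

norm : ℤ[i] → ℕ
norm (a +i b) = ℤ.∣ a ∣ ℕ.* ℤ.∣ a ∣ ℕ.+ ℤ.∣ b ∣ ℕ.* ℤ.∣ b ∣

norm-*ᵢ : ∀ z w → norm (z *ᵢ w) ≡ norm z ℕ.* norm w
norm-*ᵢ (a +i b) (c +i d) = ℤ.+-injective (begin
  + norm ((a +i b) *ᵢ (c +i d))                    ≡⟨ sym (norm-as-ℤ (a ℤ.* c ℤ.- b ℤ.* d) (a ℤ.* d ℤ.+ b ℤ.* c)) ⟩
  (a ℤ.* c ℤ.- b ℤ.* d) ℤ.* (a ℤ.* c ℤ.- b ℤ.* d) ℤ.+ (a ℤ.* d ℤ.+ b ℤ.* c) ℤ.* (a ℤ.* d ℤ.+ b ℤ.* c)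
    ≡⟨ ℤ-Solver.solve 4 (λ a b c d → (a :* c :- b :* d) :* (a :* c :- b :* d) :+ (a :* d :+ b :* c) :* (a :* d :+ b :* c)
                                     := (a :* a :+ b :* b) :* (c :* c :+ d :* d)) refl a b c d ⟩
  (a ℤ.* a ℤ.+ b ℤ.* b) ℤ.* (c ℤ.* c ℤ.+ d ℤ.* d)   ≡⟨ cong₂ ℤ._*_ (norm-as-ℤ a b) (norm-as-ℤ c d) ⟩
  + norm (a +i b) ℤ.* + norm (c +i d)               ≡⟨ sym (ℤ.pos-* (norm (a +i b)) (norm (c +i d))) ⟩
  + (norm (a +i b) ℕ.* norm (c +i d))               ∎)
  where
  open ≡-Reasoning
  open ℤ-Solver using (_:+_; _:*_; _:-_; _:=_)
  square : ∀ a → a ℤ.* a ≡ + (ℤ.∣ a ∣ ℕ.* ℤ.∣ a ∣)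
  square (+ zero)  = refl
  square (+ suc n) = refl
  square -[1+ n ]  = refl
  norm-as-ℤ : ∀ a b → a ℤ.* a ℤ.+ b ℤ.* b ≡ + norm (a +i b)
  norm-as-ℤ a b = cong₂ ℤ._+_ (square a) (square b)

-- Divisibility

prime⇒2≤ : ∀ {p} → Prime p → 2 ≤ p
prime⇒2≤ {p} pp = ℕ.nonTrivial⇒n>1 p ⦃ prime⇒nonTrivial pp ⦄

∣⇒1≤ : ∀ {d n} → d ∣ n → 1 ≤ n → 1 ≤ d
∣⇒1≤ {zero}  0∣n 1≤n = contradiction (ℕ.0∣⇒≡0 0∣n) (ℕ.<⇒≢ 1≤n ∘ sym)
∣⇒1≤ {suc d} _   _   = s≤s z≤n

1≤p^ : ∀ {p} a → Prime p → 1 ≤ p ^ a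
1≤p^ a pp = ℕ.m^n>0 _ ⦃ prime⇒nonZero pp ⦄ a

prime-∣ : ∀ {k} → 2 ≤ k → ∃ λ p → Prime p × p ∣ k
prime-∣ {k@(suc _)} 2≤k with factorise k
... | record { factors = [] ; isFactorisation = k≡1 } = contradiction k≡1 (ℕ.<⇒≢ 2≤k ∘ sym)
... | record { factors = p ∷ ps ; isFactorisation = k≡∏ ; factorsPrime = pp ∷ _ } =
  p , pp , subst (p ∣_) (sym k≡∏) (ℕ.m∣m*n _)

p-adic-decomposition : ∀ {p} k → Prime p → 1 ≤ k → ∃₂ λ a r → k ≡ p ^ a * r × ¬ p ∣ r
p-adic-decomposition {p} k pp = <-rec (λ k → 1 ≤ k → ∃₂ λ a r → k ≡ p ^ a * r × ¬ p ∣ r) step k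
  where
  step : ∀ k → (∀ {q} → q < k → 1 ≤ q → ∃₂ λ a r → q ≡ p ^ a * r × ¬ p ∣ r) → 1 ≤ k → ∃₂ λ a r → k ≡ p ^ a * r × ¬ p ∣ r
  step k rec 1≤k with p ∣? k
  ... | no p∤k = 0 , k , sym (ℕ.+-identityʳ k) , p∤k
  ... | yes (divides q k≡qp) with rec q<k 1≤q
    where
    1≤q : 1 ≤ q
    1≤q = ∣⇒1≤ (divides p (trans k≡qp (ℕ.*-comm q p))) 1≤k
    q<k : q < k
    q<k = subst (q <_) (sym k≡qp) (ℕ.m<m*n q p ⦃ ℕ.>-nonZero 1≤q ⦄ (prime⇒2≤ pp))
  ... | a , r , q≡p^a*r , p∤r = suc a , r , eq , p∤r
    where
    eq : k ≡ p ^ suc a * r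
    eq = trans k≡qp (trans (cong (_* p) q≡p^a*r) (trans (ℕ.*-comm (p ^ a * r) p) (sym (ℕ.*-assoc p (p ^ a) r))))

coprime-∣-p^*ʳ : ∀ {p x} a y → Prime p → ¬ p ∣ x → x ∣ p ^ a * y → x ∣ y
coprime-∣-p^*ʳ zero    y pp p∤x x∣y = subst (_ ∣_) (ℕ.+-identityʳ y) x∣y
coprime-∣-p^*ʳ {p} {x} (suc a) y pp p∤x x∣ =
  coprime-∣-p^*ʳ a y pp p∤x (coprime-divisor coprime (subst (x ∣_) (ℕ.*-assoc p (p ^ a) y) x∣))
  where
  coprime : Coprime x p
  coprime (d∣x , d∣p) with prime⇒irreducible pp d∣p
  ... | inj₁ d≡1    = d≡1
  ... | inj₂ refl   = contradiction d∣x p∤x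

p^∣p^*⇒≤ : ∀ {p r} b c → Prime p → ¬ p ∣ r → p ^ b ∣ p ^ c * r → b ≤ c
p^∣p^*⇒≤ zero    c       pp p∤r _ = z≤n
p^∣p^*⇒≤ {p} {r} (suc b) zero pp p∤r p^∣r =
  contradiction (ℕ.∣-trans (ℕ.m∣m*n (p ^ b)) (subst (p * p ^ b ∣_) (ℕ.+-identityʳ r) p^∣r)) p∤r
p^∣p^*⇒≤ {p} {r} (suc b) (suc c) pp p∤r p^∣ =
  s≤s (p^∣p^*⇒≤ b c pp p∤r (ℕ.*-cancelˡ-∣ p ⦃ prime⇒nonZero pp ⦄ (subst (p * p ^ b ∣_) (ℕ.*-assoc p (p ^ c) r) p^∣)))

p^≤⇒∣ : ∀ p {b a} → b ≤ a → p ^ b ∣ p ^ a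
p^≤⇒∣ p {b} {a} b≤a = divides (p ^ (a ∸ b))
  (trans (cong (p ^_) (sym (ℕ.m∸n+n≡m b≤a))) (ℕ.^-distribˡ-+-* p (a ∸ b) b))

p^[1+a]∣ : ∀ {p r e} a → Prime p → ¬ p ∣ r → 1 ≤ r → e ∣ p ^ suc a * r → ¬ e ∣ p ^ a * r → p ^ suc a ∣ e
p^[1+a]∣ {p} {r} {e} a pp p∤r 1≤r e∣ e∤
  with p-adic-decomposition e pp (∣⇒1≤ e∣ (ℕ.*-mono-≤ (1≤p^ (suc a) pp) 1≤r))
... | b , e′ , e≡ , p∤e′ with ℕ.≤-<-connex b a
...   | inj₁ b≤a = contradiction (subst (_∣ p ^ a * r) (sym e≡) (ℕ.*-pres-∣ (p^≤⇒∣ p b≤a) e′∣r)) e∤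
  where
  e′∣r : e′ ∣ r
  e′∣r = coprime-∣-p^*ʳ (suc a) r pp p∤e′ (ℕ.∣-trans (divides (p ^ b) e≡) e∣)
...   | inj₂ a<b = subst (p ^ suc a ∣_) (sym e≡) (ℕ.∣-trans (p^≤⇒∣ p a<b) (ℕ.m∣m*n e′))

∣p^⇒≡p : ∀ {p q} j → Prime p → Prime q → p ∣ q ^ j → p ≡ q
∣p^⇒≡p {p} {q} zero    pp pq p∣1 = contradiction (ℕ.∣1⇒≡1 p∣1) (ℕ.<⇒≢ (prime⇒2≤ pp) ∘ sym)
∣p^⇒≡p {p} {q} (suc j) pp pq p∣ with euclidsLemma q (q ^ j) pp p∣
... | inj₂ p∣q^j = ∣p^⇒≡p j pp pq p∣q^j
... | inj₁ p∣q with prime⇒irreducible pq p∣q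
...   | inj₁ p≡1 = contradiction p≡1 (ℕ.<⇒≢ (prime⇒2≤ pp) ∘ sym)
...   | inj₂ p≡q = p≡q

IsPrimePower : ℕ → Set
IsPrimePower k = ∃₂ λ q j → Prime q × 1 ≤ j × k ≡ q ^ j

p^*-not-prime-power : ∀ {p e} a → Prime p → ¬ p ∣ e → 2 ≤ e → ¬ IsPrimePower (p ^ suc a * e)
p^*-not-prime-power {p} {e} a pp p∤e 2≤e (q , j , pq , _ , eq)
  with ∣p^⇒≡p j pp pq (subst (p ∣_) eq (ℕ.∣-trans (ℕ.m∣m*n (p ^ a)) (ℕ.m∣m*n e)))
... | refl = ℕ.<⇒≢ 2≤e (sym (ℕ.∣1⇒≡1 (coprime-∣-p^*ʳ j 1 pp p∤e e∣p^j)))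
  where
  e∣p^j : e ∣ p ^ j * 1
  e∣p^j = subst (e ∣_) (trans eq (sym (ℕ.*-identityʳ (p ^ j)))) (ℕ.n∣m*n (p ^ suc a))

∣2^*∧4∤⇒∣2* : ∀ {u d} a → ¬ 2 ∣ u → d ∣ 2 ^ a * u → ¬ 4 ∣ d → d ∣ 2 * u
∣2^*∧4∤⇒∣2* {u} {d} a 2∤u d∣ 4∤d with p-adic-decomposition d prime[2] (∣⇒1≤ d∣ (ℕ.*-mono-≤ (1≤p^ a prime[2]) 1≤u))
  where
  1≤u : 1 ≤ u
  1≤u = ℕ.n≢0⇒n>0 (λ { refl → 2∤u (2 ℕ.∣0) })
... | b , d′ , d≡ , 2∤d′ = subst (_∣ 2 * u) (sym d≡) (ℕ.*-pres-∣ (p^≤⇒∣ 2 b≤1) d′∣u)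
  where
  d′∣u : d′ ∣ u
  d′∣u = coprime-∣-p^*ʳ a u prime[2] 2∤d′ (ℕ.∣-trans (divides (2 ^ b) d≡) d∣)
  b≤1 : b ≤ 1
  b≤1 = ℕ.≮⇒≥ (λ 1<b → 4∤d (subst (4 ∣_) (sym d≡) (ℕ.∣-trans (p^≤⇒∣ 2 1<b) (ℕ.m∣m*n d′))))

-- Cyclotomic polynomials at i

private
  module ∏ₚ = FilteredProduct (CommutativeRing.*-commutativeMonoid ℤ[X])
open FilteredProduct (CommutativeRing.*-commutativeMonoid ℤ[i]-commutativeRing)

V : ℕ → ℤ[i]
V n = evalAtI (Φ n)

evalAtI-∏ : ∀ n {P} (P? : Decidable P) f → evalAtI (∏ₚ.∏ n P? f) ≡ ∏ n P? (evalAtI ∘ f)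
evalAtI-∏ = ∏-homomorphic (CommutativeRing.*-commutativeMonoid ℤ[X]) (CommutativeRing.*-commutativeMonoid ℤ[i]-commutativeRing)
              evalAtI refl evalAtI-*ₚ

∏V-divisors : ∀ n → 1 ≤ n → ∏ n (_∣? n) V ≡ 𝕚 ^ᵢ n +ᵢ -ᵢ 1ᵢ
∏V-divisors n 1≤n = trans (sym (evalAtI-∏ n (_∣? n) Φ)) (trans (evalAtI-cong (∏Φ-divisors≈X^n-1 n 1≤n)) (evalAtI-X^-1 n))

𝕚^-≡ : ∀ {n} r q → n ≡ r ℕ.+ q * 4 → 𝕚 ^ᵢ n ≡ 𝕚 ^ᵢ r
𝕚^-≡ r q n≡ = trans (cong (𝕚 ^ᵢ_) (trans n≡ (cong (r ℕ.+_) (ℕ.*-comm q 4)))) (𝕚^-periodic r q)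

norm-𝕚^-1 : ∀ n → ¬ 4 ∣ n → norm (𝕚 ^ᵢ n +ᵢ -ᵢ 1ᵢ) ≡ 2 ⊎ (2 ∣ n × norm (𝕚 ^ᵢ n +ᵢ -ᵢ 1ᵢ) ≡ 4)
norm-𝕚^-1 n 4∤n with n % 4 | ℕ.m%n<n n 4 | ℕ.m≡m%n+[m/n]*n n 4
... | 0 | _ | n≡ = contradiction (divides (n / 4) n≡) 4∤n
... | 1 | _ | n≡ = inj₁ (cong (λ z → norm (z +ᵢ -ᵢ 1ᵢ)) (𝕚^-≡ 1 (n / 4) n≡))
... | 2 | _ | n≡ = inj₂ (divides (1 ℕ.+ n / 4 * 2) (trans n≡ (lemma (n / 4))) ,
                        cong (λ z → norm (z +ᵢ -ᵢ 1ᵢ)) (𝕚^-≡ 2 (n / 4) n≡))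
  where
  lemma : ∀ q → 2 ℕ.+ q * 4 ≡ (1 ℕ.+ q * 2) * 2
  lemma q = cong (2 ℕ.+_) (sym (ℕ.*-assoc q 2 2))
... | 3 | _ | n≡ = inj₁ (cong (λ z → norm (z +ᵢ -ᵢ 1ᵢ)) (𝕚^-≡ 3 (n / 4) n≡))
... | suc (suc (suc (suc _))) | s≤s (s≤s (s≤s (s≤s ()))) | _

norm-V-unit : ∀ n → 3 ≤ n → ¬ 4 ∣ n → norm (V n) ≡ 1
norm-V-unit n 3≤n 4∤n = [ odd , even ]′ (norm-𝕚^-1 n 4∤n)
  where
  open ≡-Reasoning
  1≤n : 1 ≤ n
  1≤n = ℕ.≤-trans (s≤s z≤n) 3≤n
  P₁ : Decidable ((_∣ n) ∩ ∁ (_≡ 1))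
  P₁ = (_∣? n) ∩? ∁? (ℕ._≟ 1)
  P₂ : Decidable (((_∣ n) ∩ ∁ (_≡ 1)) ∩ ∁ (_≡ n))
  P₂ = P₁ ∩? ∁? (ℕ._≟ n)
  P₃ : Decidable ((((_∣ n) ∩ ∁ (_≡ 1)) ∩ ∁ (_≡ n)) ∩ ∁ (_≡ 2))
  P₃ = P₂ ∩? ∁? (ℕ._≟ 2)
  norm-split : norm (𝕚 ^ᵢ n +ᵢ -ᵢ 1ᵢ) ≡ 2 * (norm (V n) * norm (∏ n P₂ V))
  norm-split = begin
    norm (𝕚 ^ᵢ n +ᵢ -ᵢ 1ᵢ)                 ≡⟨ cong norm (sym (∏V-divisors n 1≤n)) ⟩
    norm (∏ n (_∣? n) V)                   ≡⟨ cong norm (∏-extract (_∣? n) V (s≤s z≤n) 1≤n (ℕ.1∣ n)) ⟩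
    norm (V 1 *ᵢ ∏ n P₁ V)                 ≡⟨ cong (λ z → norm (V 1 *ᵢ z)) (∏-extract P₁ V 1≤n ℕ.≤-refl (ℕ.∣-refl , n≢1)) ⟩
    norm (V 1 *ᵢ (V n *ᵢ ∏ n P₂ V))        ≡⟨ norm-*ᵢ (V 1) (V n *ᵢ ∏ n P₂ V) ⟩
    2 * norm (V n *ᵢ ∏ n P₂ V)             ≡⟨ cong (2 *_) (norm-*ᵢ (V n) (∏ n P₂ V)) ⟩
    2 * (norm (V n) * norm (∏ n P₂ V))     ∎
    where
    n≢1 : n ≢ 1
    n≢1 n≡1 = ℕ.<⇒≱ 3≤n (ℕ.≤-trans (ℕ.≤-reflexive n≡1) (s≤s z≤n))
  odd : norm (𝕚 ^ᵢ n +ᵢ -ᵢ 1ᵢ) ≡ 2 → norm (V n) ≡ 1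
  odd norm≡2 = ℕ.m*n≡1⇒m≡1 (norm (V n)) (norm (∏ n P₂ V)) (ℕ.*-cancelˡ-≡ _ 1 2 (trans (sym norm-split) norm≡2))
  even : 2 ∣ n × norm (𝕚 ^ᵢ n +ᵢ -ᵢ 1ᵢ) ≡ 4 → norm (V n) ≡ 1
  even (2∣n , norm≡4) = ℕ.m*n≡1⇒m≡1 (norm (V n)) (norm (∏ n P₃ V))
      (ℕ.*-cancelˡ-≡ _ 1 2 (ℕ.*-cancelˡ-≡ _ 2 2 (begin
        2 * (2 * (norm (V n) * norm (∏ n P₃ V)))   ≡⟨ cong (2 *_) (rearrange (norm (V n)) (norm (∏ n P₃ V))) ⟩
        2 * (norm (V n) * (2 * norm (∏ n P₃ V)))   ≡⟨ cong (λ m → 2 * (norm (V n) * m)) (sym (norm-*ᵢ (V 2) (∏ n P₃ V))) ⟩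
        2 * (norm (V n) * norm (V 2 *ᵢ ∏ n P₃ V))  ≡⟨ cong (λ z → 2 * (norm (V n) * norm z)) (sym V₂-split) ⟩
        2 * (norm (V n) * norm (∏ n P₂ V))          ≡⟨ sym norm-split ⟩
        norm (𝕚 ^ᵢ n +ᵢ -ᵢ 1ᵢ)                      ≡⟨ norm≡4 ⟩
        2 * 2                                       ∎)))
    where
    V₂-split : ∏ n P₂ V ≡ V 2 *ᵢ ∏ n P₃ V
    V₂-split = ∏-extract P₂ V (s≤s z≤n) (ℕ.≤-trans (s≤s (s≤s z≤n)) 3≤n) ((2∣n , λ ()) , ℕ.<⇒≢ 3≤n)
    rearrange : ∀ a b → 2 * (a * b) ≡ a * (2 * b)
    rearrange a b = trans (sym (ℕ.*-assoc 2 a b)) (trans (cong (_* b) (ℕ.*-comm 2 a)) (ℕ.*-assoc a 2 b))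

-- Φ 4 = X² + 1 vanishes at i; dividing it out of X^4k - 1 = (X^4 - 1)(1 + X^4 + ⋯)
-- leaves (X² - 1)(1 + X^4 + ⋯).
∏Φ-divisors-without-4 : ∀ k → 1 ≤ k →
  ∏ₚ.∏ (4 * k) ((_∣? 4 * k) ∩? ∁? (ℕ._≟ 4)) Φ ≈ₚ (X^ 2 -ₚ 1ₚ) *ₚ geom 4 k
∏Φ-divisors-without-4 k 1≤k = *ₚ-cancelʳ-monic (Φ-monic 4) (begin
  R *ₚ Φ 4                          ≈⟨ *ₚ-comm R (Φ 4) ⟩
  Φ 4 *ₚ R                          ≈⟨ ≈ₚ-sym (∏ₚ.∏-extract (_∣? 4 * k) Φ (s≤s z≤n) 4≤4k (ℕ.m∣m*n k)) ⟩
  ∏ₚ.∏ (4 * k) (_∣? 4 * k) Φ         ≈⟨ ∏Φ-divisors≈X^n-1 (4 * k) (ℕ.≤-trans (s≤s z≤n) 4≤4k) ⟩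
  X^ (4 * k) -ₚ 1ₚ                  ≈⟨ ≈ₚ-sym (geom-* 4 k) ⟩
  geom 4 k *ₚ (X^ 4 -ₚ 1ₚ)          ≡⟨⟩
  geom 4 k *ₚ (Φ 4 *ₚ (X^ 2 -ₚ 1ₚ)) ≈⟨ solve 3 (λ G F Y → G :* (F :* Y) := (Y :* G) :* F) ≈ₚ-refl (geom 4 k) (Φ 4) (X^ 2 -ₚ 1ₚ) ⟩
  ((X^ 2 -ₚ 1ₚ) *ₚ geom 4 k) *ₚ Φ 4 ∎)
  where
  open import Relation.Binary.Reasoning.Setoid ≈ₚ-setoid
  open ℤ[X]-Solver using (solve; _:*_; _:=_)
  R : Poly
  R = ∏ₚ.∏ (4 * k) ((_∣? 4 * k) ∩? ∁? (ℕ._≟ 4)) Φ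
  4≤4k : 4 ≤ 4 * k
  4≤4k = ℕ.*-monoʳ-≤ 4 1≤k

𝕚^2*odd : ∀ {u} → ¬ 2 ∣ u → 𝕚 ^ᵢ (2 * u) ≡ 𝕚 ^ᵢ 2
𝕚^2*odd {u} 2∤u with u % 2 | ℕ.m%n<n u 2 | ℕ.m≡m%n+[m/n]*n u 2
... | 0 | _ | u≡ = contradiction (divides (u / 2) u≡) 2∤u
... | 1 | _ | u≡ = 𝕚^-≡ 2 (u / 2) (trans (cong (2 *_) u≡) (double-odd (u / 2)))
  where
  double-odd : ∀ q → 2 * (1 ℕ.+ q * 2) ≡ 2 ℕ.+ q * 4
  double-odd q = trans (ℕ.*-distribˡ-+ 2 1 (q * 2)) (cong (2 ℕ.+_) (trans (ℕ.*-comm 2 (q * 2)) (ℕ.*-assoc q 2 2)))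
... | suc (suc _) | s≤s (s≤s ()) | _

-- For k = 2^a u with u odd, the divisors of 4k not divisible by 4 are those of 2u.
∏V-divisors-not-4∣ : ∀ k → 1 ≤ k → ∏ (4 * k) (((_∣? 4 * k) ∩? ∁? (ℕ._≟ 4)) ∩? ∁? (4 ∣?_)) V ≡ ι -[1+ 1 ]
∏V-divisors-not-4∣ k 1≤k with p-adic-decomposition k prime[2] 1≤k
... | a , u , k≡ , 2∤u = begin
  ∏ (4 * k) (((_∣? 4 * k) ∩? ∁? (ℕ._≟ 4)) ∩? ∁? (4 ∣?_)) V  ≡⟨ ∏-congᵖ (4 * k) _ (_∣? 2 * u) (λ _ _ → to) (λ _ _ → from) ⟩
  ∏ (4 * k) (_∣? 2 * u) V
    ≡⟨ ∏-range (_∣? 2 * u) V 2u≤4k (λ 2u<j _ j∣2u → ℕ.<⇒≱ 2u<j (ℕ.∣⇒≤ ⦃ ℕ.>-nonZero 1≤2u ⦄ j∣2u)) ⟩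
  ∏ (2 * u) (_∣? 2 * u) V                                  ≡⟨ ∏V-divisors (2 * u) 1≤2u ⟩
  𝕚 ^ᵢ (2 * u) +ᵢ -ᵢ 1ᵢ                                     ≡⟨ cong (_+ᵢ -ᵢ 1ᵢ) (𝕚^2*odd 2∤u) ⟩
  ι -[1+ 1 ]                                               ∎
  where
  open ≡-Reasoning
  4k≡ : 4 * k ≡ 2 ^ (2 ℕ.+ a) * u
  4k≡ = trans (cong (4 *_) k≡) (trans (sym (ℕ.*-assoc 4 (2 ^ a) u)) (cong (_* u) (ℕ.*-assoc 2 2 (2 ^ a))))
  2u∣4k : 2 * u ∣ 4 * k
  2u∣4k = subst (2 * u ∣_) (sym 4k≡) (ℕ.*-monoˡ-∣ u (p^≤⇒∣ 2 {1} {2 ℕ.+ a} (s≤s z≤n)))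
  1≤u : 1 ≤ u
  1≤u = ℕ.n≢0⇒n>0 (λ { refl → 2∤u (2 ℕ.∣0) })
  1≤2u : 1 ≤ 2 * u
  1≤2u = ℕ.≤-trans 1≤u (ℕ.m≤n*m u 2)
  2u≤4k : 2 * u ≤ 4 * k
  2u≤4k = ℕ.∣⇒≤ ⦃ ℕ.>-nonZero (ℕ.≤-trans 1≤k (ℕ.m≤n*m k 4)) ⦄ 2u∣4k
  4∤ : ∀ {d} → d ∣ 2 * u → ¬ 4 ∣ d
  4∤ d∣2u 4∣d = 2∤u (ℕ.*-cancelˡ-∣ 2 (ℕ.∣-trans 4∣d d∣2u))
  to : ∀ {d} → ((d ∣ 4 * k × d ≢ 4) × ¬ 4 ∣ d) → d ∣ 2 * u
  to {d} ((d∣4k , _) , 4∤d) = ∣2^*∧4∤⇒∣2* (2 ℕ.+ a) 2∤u (subst (d ∣_) 4k≡ d∣4k) 4∤d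
  from : ∀ {d} → d ∣ 2 * u → ((d ∣ 4 * k × d ≢ 4) × ¬ 4 ∣ d)
  from d∣2u = (ℕ.∣-trans d∣2u 2u∣4k , (λ { refl → 4∤ d∣2u ℕ.∣-refl })) , 4∤ d∣2u

W : ℕ → ℤ[i]
W e = V (4 * e)

∏W-divisors : ∀ k → 1 ≤ k → ∏ k ((_∣? k) ∩? ∁? (ℕ._≟ 1)) W ≡ ι (+ k)
∏W-divisors k 1≤k = ι-*ᵢ-cancel -[1+ 1 ] (λ ()) (begin
  ι -[1+ 1 ] *ᵢ F                               ≡⟨ *ᵢ-comm (ι -[1+ 1 ]) F ⟩
  F *ᵢ ι -[1+ 1 ]                               ≡⟨ cong₂ _*ᵢ_ (sym multiples-of-4) (sym (∏V-divisors-not-4∣ k 1≤k)) ⟩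
  ∏ (4 * k) (P ∩? (4 ∣?_)) V *ᵢ ∏ (4 * k) (P ∩? ∁? (4 ∣?_)) V ≡⟨ sym (∏-split (4 * k) P (4 ∣?_) V) ⟩
  ∏ (4 * k) P V                                 ≡⟨ sym (evalAtI-∏ (4 * k) P Φ) ⟩
  evalAtI (∏ₚ.∏ (4 * k) P Φ)                     ≡⟨ evalAtI-cong (∏Φ-divisors-without-4 k 1≤k) ⟩
  evalAtI ((X^ 2 -ₚ 1ₚ) *ₚ geom 4 k)             ≡⟨ evalAtI-*ₚ (X^ 2 -ₚ 1ₚ) (geom 4 k) ⟩
  evalAtI (X^ 2 -ₚ 1ₚ) *ᵢ evalAtI (geom 4 k)     ≡⟨ cong (evalAtI (X^ 2 -ₚ 1ₚ) *ᵢ_) (evalAtI-geom4 k) ⟩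
  ι -[1+ 1 ] *ᵢ ι (+ k)                          ∎)
  where
  open ≡-Reasoning
  P : Decidable ((_∣ 4 * k) ∩ ∁ (_≡ 4))
  P = (_∣? 4 * k) ∩? ∁? (ℕ._≟ 4)
  F : ℤ[i]
  F = ∏ k ((_∣? k) ∩? ∁? (ℕ._≟ 1)) W
  multiples-of-4 : ∏ (4 * k) (P ∩? (4 ∣?_)) V ≡ F
  multiples-of-4 = trans (∏-scale 4 k (P ∩? (4 ∣?_)) V proj₂)
                         (∏-congᵖ k _ ((_∣? k) ∩? ∁? (ℕ._≟ 1)) (λ _ _ → to) (λ _ _ → from))
    where
    to : ∀ {e} → (4 * e ∣ 4 * k × 4 * e ≢ 4) × 4 ∣ 4 * e → e ∣ k × e ≢ 1
    to ((scaled∣ , scaled≢4) , _) = ℕ.*-cancelˡ-∣ 4 scaled∣ , λ e≡1 → scaled≢4 (cong (4 *_) e≡1)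
    from : ∀ {e} → e ∣ k × e ≢ 1 → (4 * e ∣ 4 * k × 4 * e ≢ 4) × 4 ∣ 4 * e
    from {e} (e∣k , e≢1) = (ℕ.*-monoʳ-∣ 4 e∣k , λ scaled≡4 → e≢1 (ℕ.*-cancelˡ-≡ e 1 4 scaled≡4)) , ℕ.m∣m*n e

∏-divisors-of-divisor : ∀ {m k} f → 1 ≤ k → m ∣ k →
  ∏ k (((_∣? k) ∩? ∁? (ℕ._≟ 1)) ∩? (_∣? m)) f ≡ ∏ m ((_∣? m) ∩? ∁? (ℕ._≟ 1)) f
∏-divisors-of-divisor {m} {k} f 1≤k m∣k = trans
  (∏-congᵖ k _ ((_∣? m) ∩? ∁? (ℕ._≟ 1)) (λ { _ _ ((_ , e≢1) , e∣m) → e∣m , e≢1 })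
                                       (λ { _ _ (e∣m , e≢1) → (ℕ.∣-trans e∣m m∣k , e≢1) , e∣m }))
  (∏-range ((_∣? m) ∩? ∁? (ℕ._≟ 1)) f (ℕ.∣⇒≤ ⦃ ℕ.>-nonZero 1≤k ⦄ m∣k)
           (λ m<e _ (e∣m , _) → ℕ.<⇒≱ m<e (ℕ.∣⇒≤ ⦃ ℕ.>-nonZero 1≤m ⦄ e∣m)))
  where
  1≤m : 1 ≤ m
  1≤m = ∣⇒1≤ m∣k 1≤k

∏-new-divisors : ∀ {p} a r f → Prime p → ¬ p ∣ r → 1 ≤ r →
  ∏ (p ^ suc a * r) (((_∣? p ^ suc a * r) ∩? ∁? (ℕ._≟ 1)) ∩? ∁? (_∣? p ^ a * r)) f ≡ ∏ r (_∣? r) (f ∘ (p ^ suc a *_))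
∏-new-divisors {p} a r f pp p∤r 1≤r =
  trans (∏-scale P ⦃ ℕ.>-nonZero 1≤P ⦄ r _ f (λ { ((e∣k , _) , e∤m) → p^[1+a]∣ a pp p∤r 1≤r e∣k e∤m }))
        (∏-congᵖ r _ (_∣? r) (λ _ _ → to) (λ 1≤e _ → from 1≤e))
  where
  P : ℕ
  P = p ^ suc a
  1≤P : 1 ≤ P
  1≤P = 1≤p^ (suc a) pp
  P∤p^a*r : ¬ P ∣ p ^ a * r
  P∤p^a*r P∣ = ℕ.<⇒≱ ℕ.≤-refl (p^∣p^*⇒≤ (suc a) a pp p∤r P∣)
  to : ∀ {e} → ((P * e ∣ P * r × P * e ≢ 1) × ¬ P * e ∣ p ^ a * r) → e ∣ r
  to ((Pe∣Pr , _) , _) = ℕ.*-cancelˡ-∣ P ⦃ ℕ.>-nonZero 1≤P ⦄ Pe∣Pr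
  from : ∀ {e} → 1 ≤ e → e ∣ r → ((P * e ∣ P * r × P * e ≢ 1) × ¬ P * e ∣ p ^ a * r)
  from {e} 1≤e e∣r = (ℕ.*-monoʳ-∣ P e∣r , Pe≢1) , λ Pe∣ → P∤p^a*r (ℕ.∣-trans (ℕ.m∣m*n e) Pe∣)
    where
    Pe≢1 : P * e ≢ 1
    Pe≢1 Pe≡1 = ℕ.<⇒≱ (prime⇒2≤ pp) (ℕ.≤-trans (ℕ.m≤m*n p (p ^ a) ⦃ ℕ.>-nonZero (1≤p^ a pp) ⦄)
                                                (subst (P ≤_) Pe≡1 (ℕ.m≤m*n P e ⦃ ℕ.>-nonZero 1≤e ⦄)))

-- Dividing ∏W-divisors at k = p^(1+a) r by ∏W-divisors at k/p.
∏W-multiples : ∀ {p} a r → Prime p → ¬ p ∣ r → 1 ≤ r → ∏ r (_∣? r) (W ∘ (p ^ suc a *_)) ≡ ι (+ p)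
∏W-multiples {p} a r pp p∤r 1≤r = ι-*ᵢ-cancel (+ m) m≢0 (begin
  ι (+ m) *ᵢ ∏ r (_∣? r) (W ∘ (P *_))
    ≡⟨ cong₂ _*ᵢ_ (sym (trans (∏-divisors-of-divisor W 1≤k m∣k) (∏W-divisors m 1≤m)))
                  (sym (∏-new-divisors a r W pp p∤r 1≤r)) ⟩
  ∏ k (Q ∩? (_∣? m)) W *ᵢ ∏ k (Q ∩? ∁? (_∣? m)) W     ≡⟨ sym (∏-split k Q (_∣? m) W) ⟩
  ∏ k Q W                                              ≡⟨ ∏W-divisors k 1≤k ⟩
  ι (+ k)                                              ≡⟨ cong ι (trans (cong +_ (trans k≡p*m (ℕ.*-comm p m))) (ℤ.pos-* m p)) ⟩
  ι (+ m ℤ.* + p)                                      ≡⟨ _-Raw-AlmostCommutative⟶_.*-homo ι-homomorphism (+ m) (+ p) ⟩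
  ι (+ m) *ᵢ ι (+ p)                                   ∎)
  where
  open ≡-Reasoning
  P m k : ℕ
  P = p ^ suc a
  m = p ^ a * r
  k = P * r
  Q : Decidable ((_∣ k) ∩ ∁ (_≡ 1))
  Q = (_∣? k) ∩? ∁? (ℕ._≟ 1)
  1≤m : 1 ≤ m
  1≤m = ℕ.*-mono-≤ (1≤p^ a pp) 1≤r
  1≤k : 1 ≤ k
  1≤k = ℕ.*-mono-≤ (1≤p^ (suc a) pp) 1≤r
  k≡p*m : k ≡ p * m
  k≡p*m = ℕ.*-assoc p (p ^ a) r
  m∣k : m ∣ k
  m∣k = divides p k≡p*m
  m≢0 : + m ≢ + 0
  m≢0 m≡0 = ℕ.<⇒≢ 1≤m (sym (ℤ.+-injective m≡0))

W-prime-power : ∀ {p} a → Prime p → W (p ^ suc a) ≡ ι (+ p)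
W-prime-power {p} a pp = begin
  W (p ^ suc a)                          ≡⟨ cong W (sym (ℕ.*-identityʳ (p ^ suc a))) ⟩
  W (p ^ suc a * 1)                      ≡⟨ sym (*ᵢ-identityˡ _) ⟩
  ∏ 1 (_∣? 1) (W ∘ (p ^ suc a *_))       ≡⟨ ∏W-multiples a 1 pp (λ p∣1 → ℕ.<⇒≢ (prime⇒2≤ pp) (sym (ℕ.∣1⇒≡1 p∣1))) ℕ.≤-refl ⟩
  ι (+ p)                                ∎
  where open ≡-Reasoning

W-trivial-from-divisors : ∀ {p} a r → Prime p → ¬ p ∣ r → 2 ≤ r →
  (∀ {e} → 2 ≤ e → e < r → e ∣ r → W (p ^ suc a * e) ≡ 1ᵢ) → W (p ^ suc a * r) ≡ 1ᵢ
W-trivial-from-divisors {p} a r pp p∤r 2≤r W≡1 = ι-*ᵢ-cancel (+ p) p≢0 (begin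
  ι (+ p) *ᵢ f r                     ≡⟨ cong₂ _*ᵢ_ (sym f1≡p) (sym (trans (cong (f r *ᵢ_) others-trivial) (*ᵢ-identityʳ (f r)))) ⟩
  f 1 *ᵢ (f r *ᵢ ∏ r Q₂ f)           ≡⟨ cong (f 1 *ᵢ_) (sym (∏-extract Q₁ f 1≤r ℕ.≤-refl (ℕ.∣-refl , r≢1))) ⟩
  f 1 *ᵢ ∏ r Q₁ f                    ≡⟨ sym (∏-extract (_∣? r) f (s≤s z≤n) 1≤r (ℕ.1∣ r)) ⟩
  ∏ r (_∣? r) f                      ≡⟨ ∏W-multiples a r pp p∤r 1≤r ⟩
  ι (+ p)                            ≡⟨ sym (*ᵢ-identityʳ (ι (+ p))) ⟩
  ι (+ p) *ᵢ 1ᵢ                      ∎)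
  where
  open ≡-Reasoning
  P : ℕ
  P = p ^ suc a
  f : ℕ → ℤ[i]
  f = W ∘ (P *_)
  Q₁ : Decidable ((_∣ r) ∩ ∁ (_≡ 1))
  Q₁ = (_∣? r) ∩? ∁? (ℕ._≟ 1)
  Q₂ : Decidable (((_∣ r) ∩ ∁ (_≡ 1)) ∩ ∁ (_≡ r))
  Q₂ = Q₁ ∩? ∁? (ℕ._≟ r)
  p≢0 : + p ≢ + 0
  p≢0 p≡0 = ℕ.<⇒≢ (ℕ.≤-trans (s≤s z≤n) (prime⇒2≤ pp)) (sym (ℤ.+-injective p≡0))
  1≤r : 1 ≤ r
  1≤r = ℕ.<⇒≤ 2≤r
  r≢1 : r ≢ 1
  r≢1 r≡1 = ℕ.<⇒≢ 2≤r (sym r≡1)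
  f1≡p : f 1 ≡ ι (+ p)
  f1≡p = trans (cong W (ℕ.*-identityʳ P)) (W-prime-power a pp)
  others-trivial : ∏ r Q₂ f ≡ 1ᵢ
  others-trivial = ∏-trivial r Q₂ λ 1≤e e≤r ((e∣r , e≢1) , e≢r) →
    W≡1 (ℕ.≤∧≢⇒< 1≤e (e≢1 ∘ sym)) (ℕ.≤∧≢⇒< e≤r e≢r) e∣r

W-not-prime-power : ∀ k → 2 ≤ k → ¬ IsPrimePower k → W k ≡ 1ᵢ
W-not-prime-power = <-rec (λ k → 2 ≤ k → ¬ IsPrimePower k → W k ≡ 1ᵢ) step
  where
  step : ∀ k → (∀ {j} → j < k → 2 ≤ j → ¬ IsPrimePower j → W j ≡ 1ᵢ) → 2 ≤ k → ¬ IsPrimePower k → W k ≡ 1ᵢ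
  step k rec 2≤k k-not-pp with prime-∣ 2≤k
  ... | p , pp , p∣k with p-adic-decomposition k pp (ℕ.<⇒≤ 2≤k)
  ... | zero  , r , k≡r , p∤r = contradiction (subst (p ∣_) (trans k≡r (ℕ.*-identityˡ r)) p∣k) p∤r
  ... | suc a , r , k≡ , p∤r = trans (cong W k≡) (W-trivial-from-divisors a r pp p∤r 2≤r W≡1)
    where
    P : ℕ
    P = p ^ suc a
    1≤P : 1 ≤ P
    1≤P = 1≤p^ (suc a) pp
    2≤r : 2 ≤ r
    2≤r = ℕ.≤∧≢⇒< (∣⇒1≤ (divides P k≡) (ℕ.<⇒≤ 2≤k))
                  (λ 1≡r → k-not-pp (p , suc a , pp , s≤s z≤n , trans k≡ (trans (cong (P *_) (sym 1≡r)) (ℕ.*-identityʳ P))))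
    W≡1 : ∀ {e} → 2 ≤ e → e < r → e ∣ r → W (P * e) ≡ 1ᵢ
    W≡1 {e} 2≤e e<r e∣r = rec (subst (P * e <_) (sym k≡) (ℕ.*-monoʳ-< P ⦃ ℕ.>-nonZero 1≤P ⦄ e<r))
                              (ℕ.≤-trans 2≤e (ℕ.m≤n*m e P ⦃ ℕ.>-nonZero 1≤P ⦄))
                              (p^*-not-prime-power a pp (λ p∣e → p∤r (ℕ.∣-trans p∣e e∣r)) 2≤e)

-- the units of ℤ[i], together with Φ 1 (i) = -1 + i and Φ 2 (i) = 1 + i
values-for-4∤ : List ℤ[i]
values-for-4∤ = (-[1+ 0 ] +i + 0) ∷ (-[1+ 0 ] +i + 1) ∷ (+ 0 +i -[1+ 0 ]) ∷ (+ 0 +i + 1) ∷ (+ 1 +i + 0) ∷ (+ 1 +i + 1) ∷ []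

norm≡1⇒∈ : ∀ z → norm z ≡ 1 → z ∈ values-for-4∤
norm≡1⇒∈ (+ zero +i + zero)               ()
norm≡1⇒∈ (+ zero +i + suc zero)           _  = there (there (there (here refl)))
norm≡1⇒∈ (+ zero +i + suc (suc _))        ()
norm≡1⇒∈ (+ zero +i -[1+ zero ])          _  = there (there (here refl))
norm≡1⇒∈ (+ zero +i -[1+ suc _ ])         ()
norm≡1⇒∈ (+ suc zero +i + zero)           _  = there (there (there (there (here refl))))
norm≡1⇒∈ (+ suc zero +i + suc _)          ()
norm≡1⇒∈ (+ suc zero +i -[1+ _ ])         ()
norm≡1⇒∈ (+ suc (suc _) +i _)             ()
norm≡1⇒∈ (-[1+ zero ] +i + zero)          _  = here refl
norm≡1⇒∈ (-[1+ zero ] +i + suc _)         ()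
norm≡1⇒∈ (-[1+ zero ] +i -[1+ _ ])        ()
norm≡1⇒∈ (-[1+ suc _ ] +i _)              ()

lemma2p5 : (n : ℕ) →
  (¬ (4 ∣ n) →
    evalAtI (Φ n) ∈ ((-[1+ 0 ] +i + 0) ∷ (-[1+ 0 ] +i + 1) ∷ (+ 0 +i -[1+ 0 ])
                     ∷ (+ 0 +i + 1) ∷ (+ 1 +i + 0) ∷ (+ 1 +i + 1) ∷ []))
  × (4 ∣ n →
      (n ≡ 4 → evalAtI (Φ n) ≡ (+ 0 +i + 0))
      × (∀ p j → Prime p → 1 ≤ j → n ≡ 4 * p ^ j → evalAtI (Φ n) ≡ (+ p +i + 0))
      × (n ≢ 4 → (∀ p j → Prime p → 1 ≤ j → n ≢ 4 * p ^ j) → evalAtI (Φ n) ≡ (+ 1 +i + 0)))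
lemma2p5 n = not-4∣ n , λ 4∣n → (λ { refl → refl }) , prime-power , other 4∣n
  where
  not-4∣ : ∀ n → ¬ 4 ∣ n → V n ∈ values-for-4∤
  not-4∣ zero                  4∤n = contradiction (4 ℕ.∣0) 4∤n
  not-4∣ (suc zero)            _   = there (here refl)
  not-4∣ (suc (suc zero))      _   = there (there (there (there (there (here refl)))))
  not-4∣ n@(suc (suc (suc _))) 4∤n = norm≡1⇒∈ (V n) (norm-V-unit n (s≤s (s≤s (s≤s z≤n))) 4∤n)
  prime-power : ∀ p j → Prime p → 1 ≤ j → n ≡ 4 * p ^ j → V n ≡ ι (+ p)
  prime-power p (suc a) pp _ refl = W-prime-power a pp
  other : 4 ∣ n → n ≢ 4 → (∀ p j → Prime p → 1 ≤ j → n ≢ 4 * p ^ j) → V n ≡ 1ᵢ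
  other (divides zero           refl) _   _      = refl   -- Defs sets Φ 0 = 1
  other (divides (suc zero)     refl) n≢4 _      = contradiction refl n≢4
  other (divides q@(suc (suc _)) refl) _ n≢4p^j =
    trans (cong V (ℕ.*-comm q 4)) (W-not-prime-power q (s≤s (s≤s z≤n)) q-not-prime-power)
    where
    q-not-prime-power : ¬ IsPrimePower q
    q-not-prime-power (p , j , pp , 1≤j , q≡p^j) = n≢4p^j p j pp 1≤j (trans (ℕ.*-comm q 4) (cong (4 *_) q≡p^j))
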